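{- Let $G_1$ and $G_2$ be two $K_5$-minor-free graphs, let $G=G_1\#_0G_2$ be their $0$-sum, and let $W_1,W_2\subseteq\mathbb{N}$ be finite sets. Suppose that $\operatorname{int}(M_{G_1})$ has a system of generators all of whose last coordinates lie in $W_1$ and $\operatorname{int}(M_{G_2})$ has a system of generators all of whose last coordinates lie in $W_2$. Then $\operatorname{int}(M_G)$ has a system of generators consisting of elements of the form $(\mathbf{x},\mathbf{y},\beta)$ with $\beta\in W_1\cup W_2$, $\beta\ge\max(\min W_1,\min W_2)$, $(\mathbf{x},\beta)\in\operatorname{int}(M_{G_1})$ and $(\mathbf{y},\beta)\in\operatorname{int}(M_{G_2})$, where for any choice $\beta\in W_1\cap W_2$, any generator $(\mathbf{x},\beta)\in\operatorname{int}(M_{G_1})$ and any generator $(\mathbf{y},\beta)\in\operatorname{int}(M_{G_2})$ (from the given systems) the vector $(\mathbf{x},\mathbf{y},\beta)$ is part of that system.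
   Context: For a graph $G=(V,E)$ and $A\subseteq V$, $\delta_A\in\mathbb{R}^E$ has $\delta_{A,e}=1$ if $|A\cap e|=1$ and $0$ otherwise; $M_G$ is the affine monoid generated by the vectors $(\delta_A,1)\in\mathbb{Z}^E\times\mathbb{Z}$. For an affine monoid $M$, $\operatorname{int}(M)=M\cap\operatorname{relint}(\operatorname{cone}(M))$; it is an ideal of $M$, and a system of generators of it is a set $S\subseteq\operatorname{int}(M)$ with $\operatorname{int}(M)=S+M$. The $0$-sum $G_1\#_0G_2$ of graphs sharing exactly one vertex (and no edges) is the graph with vertex set $V(G_1)\cup V(G_2)$ and edge set $E(G_1)\cup E(G_2)$; its edge coordinates are ordered with those of $E(G_1)$ first, then those of $E(G_2)$, so elements of $\mathbb{Z}^{E(G)}\times\mathbb{Z}$ are written $(\mathbf{x},\mathbf{y},\beta)$ with $\mathbf{x}\in\mathbb{Z}^{E(G_1)}$, $\mathbf{y}\in\mathbb{Z}^{E(G_2)}$. -}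

module Defs where

open import Data.Nat as ℕ using (ℕ)
open import Data.Integer as ℤ using (ℤ; +_)
open import Data.Rational as ℚ using (ℚ; 0ℚ; 1ℚ)
open import Data.Fin using (Fin; cast)
open import Data.Fin.Subset using (Subset; _∈_; _⊆_; _∪_; Nonempty)
open import Data.Bool using (Bool; _xor_; if_then_else_)
open import Data.Vec using (lookup)
open import Data.List as L using (List; []; _∷_; length; _++_; foldr; map)
open import Data.List.Properties using (length-++)
open import Data.List.Relation.Unary.All using (All)
open import Data.List.Relation.Unary.AllPairs using (AllPairs)
import Data.List.Membership.Propositional as LM
open import Data.Vec.Functional as VF using (Vector)
open import Data.Product using (Σ; ∃; ∃₂; _×_; _,_; proj₁; proj₂; swap)
open import Data.Sum using (_⊎_)
open import Data.Empty using (⊥)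
open import Relation.Binary.PropositionalEquality using (_≡_; _≢_)
open import Relation.Nullary using (¬_)

-- Points of ℤ^m × ℤ  (edge coordinates, then the last coordinate)

Pt : ℕ → Set
Pt m = Vector ℤ m × ℤ

QPt : ℕ → Set
QPt m = Vector ℚ m × ℚ

module _ {m : ℕ} where

  _≈ᵖ_ : Pt m → Pt m → Set
  (x , a) ≈ᵖ (y , b) = (∀ i → x i ≡ y i) × a ≡ b

  _≈q_ : QPt m → QPt m → Set
  (x , a) ≈q (y , b) = (∀ i → x i ≡ y i) × a ≡ b

  _+ᵖ_ : Pt m → Pt m → Pt m
  (x , a) +ᵖ (y , b) = (λ i → x i ℤ.+ y i) , a ℤ.+ b

  0ᵖ : Pt m
  0ᵖ = (λ _ → + 0) , + 0

  sumᵖ : List (Pt m) → Pt m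
  sumᵖ = foldr _+ᵖ_ 0ᵖ

  toQ : Pt m → QPt m
  toQ (x , a) = (λ i → x i ℚ./ 1) , a ℚ./ 1

  _+q_ : QPt m → QPt m → QPt m
  (x , a) +q (y , b) = (λ i → x i ℚ.+ y i) , a ℚ.+ b

  _·q_ : ℚ → QPt m → QPt m
  λ₀ ·q (x , a) = (λ i → λ₀ ℚ.* x i) , λ₀ ℚ.* a

  0q : QPt m
  0q = (λ _ → 0ℚ) , 0ℚ

  lincomb : List (ℚ × QPt m) → QPt m
  lincomb = foldr (λ c acc → (proj₁ c ·q proj₂ c) +q acc) 0q

  sumCoeffs : List (ℚ × QPt m) → ℚ
  sumCoeffs = foldr (λ c acc → proj₁ c ℚ.+ acc) 0ℚ

  Cone : (Pt m → Set) → QPt m → Set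
  Cone M y = ∃ λ (cs : List (ℚ × Pt m)) →
               All (λ c → (0ℚ ℚ.≤ proj₁ c) × M (proj₂ c)) cs
             × y ≈q lincomb (map (λ c → proj₁ c , toQ (proj₂ c)) cs)

  AffHull : (QPt m → Set) → QPt m → Set
  AffHull S z = ∃ λ (cs : List (ℚ × QPt m)) →
                  All (λ c → S (proj₂ c)) cs
                × sumCoeffs cs ≡ 1ℚ
                × z ≈q lincomb cs

  Near : ℚ → QPt m → QPt m → Set
  Near ε (x , a) (z , b) = (∀ i → ℚ.∣ z i ℚ.- x i ∣ ℚ.< ε) × ℚ.∣ b ℚ.- a ∣ ℚ.< ε

  RelInt : (QPt m → Set) → QPt m → Set
  RelInt S x = S x × ∃ λ ε → (0ℚ ℚ.< ε) × (∀ z → AffHull S z → Near ε x z → S z)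

  Int : (Pt m → Set) → Pt m → Set
  Int M p = M p × RelInt (Cone M) (toQ p)

  GenSys : (Pt m → Set) → (Pt m → Set) → (Pt m → Set) → Set
  GenSys M I S = (∀ p → S p → I p)
               × (∀ p → I p → ∃₂ λ s q → S s × M q × p ≈ᵖ (s +ᵖ q))

-- Graphs: vertex set V ⊆ Fin n, edges as a list of (ordered) vertex pairs;
-- the order of the list is the order of the edge coordinates.

record Graph (n : ℕ) : Set where
  constructor graph
  field
    V : Subset n
    E : List (Fin n × Fin n)

open Graph public

SameEdge : ∀ {n} → (Fin n × Fin n) → (Fin n × Fin n) → Set
SameEdge e f = e ≡ f ⊎ swap e ≡ f

IsSimple : ∀ {n} → Graph n → Set
IsSimple G = All (λ e → proj₁ e ∈ V G × proj₂ e ∈ V G × proj₁ e ≢ proj₂ e) (E G)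
           × AllPairs (λ e f → ¬ SameEdge e f) (E G)

Adj : ∀ {n} → Graph n → Fin n → Fin n → Set
Adj G u v = (u , v) LM.∈ E G ⊎ (v , u) LM.∈ E G

data Walk {n} (G : Graph n) (B : Subset n) : Fin n → Fin n → Set where
  here : ∀ {u} → Walk G B u u
  step : ∀ {u w v} → Adj G u w → w ∈ B → Walk G B w v → Walk G B u v

Connected : ∀ {n} → Graph n → Subset n → Set
Connected G B = ∀ u v → u ∈ B → v ∈ B → Walk G B u v

HasK5Minor : ∀ {n} → Graph n → Set
HasK5Minor {n} G =
  ∃ λ (B : Fin 5 → Subset n) →
      (∀ i → Nonempty (B i))
    × (∀ i → B i ⊆ V G)
    × (∀ i j → i ≢ j → ∀ x → x ∈ B i → x ∈ B j → ⊥)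
    × (∀ i → Connected G (B i))
    × (∀ i j → i ≢ j → ∃₂ λ u v → u ∈ B i × v ∈ B j × Adj G u v)

K5MinorFree : ∀ {n} → Graph n → Set
K5MinorFree G = ¬ HasK5Minor G

δ : ∀ {n} (G : Graph n) → Subset n → Vector ℤ (length (E G))
δ G A i with L.lookup (E G) i
... | (u , v) = if lookup A u xor lookup A v then + 1 else + 0

MG : ∀ {n} (G : Graph n) → Pt (length (E G)) → Set
MG {n} G p = ∃ λ (As : List (Subset n)) →
               All (λ A → A ⊆ V G) As
             × p ≈ᵖ sumᵖ (map (λ A → δ G A , + 1) As)

intMG : ∀ {n} (G : Graph n) → Pt (length (E G)) → Set
intMG G = Int (MG G)

ShareExactlyVertex : ∀ {n} → Graph n → Graph n → Fin n → Set
ShareExactlyVertex G₁ G₂ v =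
    v ∈ V G₁ × v ∈ V G₂
  × (∀ x → x ∈ V G₁ → x ∈ V G₂ → x ≡ v)
  × (∀ e f → e LM.∈ E G₁ → f LM.∈ E G₂ → ¬ SameEdge e f)

_#₀_ : ∀ {n} → Graph n → Graph n → Graph n
G₁ #₀ G₂ = graph (V G₁ ∪ V G₂) (E G₁ ++ E G₂)

joinVec : ∀ {n} (G₁ G₂ : Graph n) →
          Vector ℤ (length (E G₁)) → Vector ℤ (length (E G₂)) →
          Vector ℤ (length (E (G₁ #₀ G₂)))
joinVec G₁ G₂ x y i = (x VF.++ y) (cast (length-++ (E G₁)) i)

-- finite sets W ⊆ ℕ as lists

InW : List ℕ → ℤ → Set
InW W β = ∃ λ w → w LM.∈ W × β ≡ + w

GeMin : List ℕ → ℤ → Set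
GeMin W β = ∃ λ w → w LM.∈ W × (+ w) ℤ.≤ β

-- A cut of G = G₁ #₀ G₂ restricts to cuts of G₁ and G₂; conversely cuts A of G₁ and
-- B of G₂ glue to a cut of G inducing δ_A and δ_B, once B is replaced by its complement
-- if A and B disagree at the shared vertex.  So M_G, and with it its cone, is the fibre
-- product of M_{G₁} and M_{G₂} over the last coordinate, and a point of M_G is interior
-- iff both of its restrictions are.  Write the restrictions of an interior p as s₁ + q₁
-- and s₂ + q₂ with generators s₁, s₂ of last coordinates a ∈ W₁ and b ∈ W₂.  Moving cuts
-- from qᵢ into sᵢ keeps sᵢ interior and raises both last coordinates to max(a, b), where
-- the two pieces glue to a generator of the required form.

module Submission where

open import Defs
open import Data.Nat as ℕ using (ℕ; zero; suc)
import Data.Nat.Properties as ℕP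
open import Data.Integer as ℤ using (ℤ)
import Data.Integer.Properties as ℤP
open import Data.Rational as ℚ using (ℚ; 0ℚ; 1ℚ; mkℚ; _+_; _*_; _-_; -_; _≤_; _<_; ∣_∣)
import Data.Rational.Properties as ℚP
open import Data.Rational.Solver using (module +-*-Solver)
open import Data.Nat.Coprimality using (1-coprimeTo) renaming (sym to coprime-sym)
open import Data.Fin using (Fin; zero; suc; cast; splitAt; _↑ˡ_; _↑ʳ_)
import Data.Fin.Properties as Fₚ
open import Data.Fin.Subset as Sub using (Subset; _∈_; _⊆_; _∩_)
import Data.Fin.Subset.Properties as Subₚ
open import Data.Bool using (Bool; true; false; _xor_; _∧_; if_then_else_)
import Data.Bool.Properties as Boolₚ
open import Data.Vec as Vec using (lookup; tabulate)
import Data.Vec.Properties as Vecₚ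
import Data.Vec.Functional as VF
open import Data.List as L using (List; []; _∷_; _++_; map; length; replicate; take; drop)
import Data.List.Properties as Lₚ
open import Data.List.Properties using (length-++)
open import Data.List.Relation.Unary.All as All using (All; []; _∷_)
import Data.List.Relation.Unary.All.Properties as Allₚ
open import Data.Vec.Functional using (Vector)
open import Data.Product using (∃; ∃₂; _×_; _,_; proj₁; proj₂)
open import Data.Sum using (_⊎_; inj₁; inj₂; [_,_]′)
import Data.Sum.Properties as Sumₚ
open import Relation.Binary.PropositionalEquality
open import Relation.Nullary using (yes; no)
open import Data.List.Membership.Propositional.Properties using (∈-lookup)
import Data.List.Membership.Propositional as LM
open import Algebra.Properties.AbelianGroup ℤP.+-0-abelianGroup using () renaming (∙-cancelˡ to +-cancelˡ)

ι : ℤ → ℚ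
ι a = a ℚ./ 1

ι≡mkℚ : ∀ a → ι a ≡ mkℚ a 0 (coprime-sym (1-coprimeTo _))
ι≡mkℚ a = ℚP.↥p/↧p≡p (mkℚ a 0 (coprime-sym (1-coprimeTo _)))

ι-homo-+ : ∀ a b → ι (a ℤ.+ b) ≡ ι a + ι b
ι-homo-+ a b rewrite ι≡mkℚ a | ι≡mkℚ b | ℤP.*-identityʳ a | ℤP.*-identityʳ b = refl

0≤1 : 0ℚ ≤ 1ℚ
0≤1 = ℚ.*≤* (ℤ.+≤+ ℕ.z≤n)

0≤*0≤ : ∀ {a b} → 0ℚ ≤ a → 0ℚ ≤ b → 0ℚ ≤ a * b
0≤*0≤ {a} {b} 0≤a 0≤b = ℚP.nonNegative⁻¹ (a * b)
  {{ℚP.nonNeg*nonNeg⇒nonNeg a {{ℚ.nonNegative 0≤a}} b {{ℚ.nonNegative 0≤b}}}}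

inverse-nonNeg : ∀ γ → 0ℚ ≤ γ → γ ≢ 0ℚ → ∃ λ c → 0ℚ ≤ c × γ * c ≡ 1ℚ
inverse-nonNeg γ 0≤γ γ≢0 =
  ℚ.1/ γ , ℚP.<⇒≤ (ℚP.positive⁻¹ _ {{ℚP.1/pos⇒pos γ}}) , ℚP.*-inverseʳ γ
  where
  instance
    γ-pos : ℚ.Positive γ
    γ-pos = ℚP.nonNeg∧nonZero⇒pos γ {{ℚ.nonNegative 0≤γ}} {{ℚ.≢-nonZero γ≢0}}
    γ-nonZero : ℚ.NonZero γ
    γ-nonZero = ℚP.pos⇒nonZero γ

∑ : ∀ {A : Set} → (A → ℚ) → List A → ℚ
∑ f [] = 0ℚ
∑ f (x ∷ xs) = f x + ∑ f xs

module _ {A : Set} where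

  ∑-++ : ∀ (f : A → ℚ) xs ys → ∑ f (xs ++ ys) ≡ ∑ f xs + ∑ f ys
  ∑-++ f [] ys = sym (ℚP.+-identityˡ _)
  ∑-++ f (x ∷ xs) ys = trans (cong (f x +_) (∑-++ f xs ys)) (sym (ℚP.+-assoc (f x) _ _))

  ∑-cong : ∀ {f g : A → ℚ} xs → (∀ x → f x ≡ g x) → ∑ f xs ≡ ∑ g xs
  ∑-cong [] f≗g = refl
  ∑-cong (x ∷ xs) f≗g = cong₂ _+_ (f≗g x) (∑-cong xs f≗g)

  ∑-congᴬ : ∀ {f g : A → ℚ} {xs} → All (λ x → f x ≡ g x) xs → ∑ f xs ≡ ∑ g xs
  ∑-congᴬ [] = refl
  ∑-congᴬ (e ∷ es) = cong₂ _+_ e (∑-congᴬ es)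

  ∑-*ˡ : ∀ t (f : A → ℚ) xs → ∑ (λ x → t * f x) xs ≡ t * ∑ f xs
  ∑-*ˡ t f [] = sym (ℚP.*-zeroʳ t)
  ∑-*ˡ t f (x ∷ xs) = trans (cong (t * f x +_) (∑-*ˡ t f xs)) (sym (ℚP.*-distribˡ-+ t (f x) _))

  ∑-*ʳ : ∀ t (f : A → ℚ) xs → ∑ (λ x → f x * t) xs ≡ ∑ f xs * t
  ∑-*ʳ t f xs = trans (∑-cong xs (λ x → ℚP.*-comm (f x) t)) (trans (∑-*ˡ t f xs) (ℚP.*-comm t _))

  ∑-0 : ∀ (xs : List A) → ∑ (λ _ → 0ℚ) xs ≡ 0ℚ
  ∑-0 [] = refl
  ∑-0 (x ∷ xs) = trans (ℚP.+-identityˡ _) (∑-0 xs)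

  ∑-nonNeg : ∀ {f : A → ℚ} {xs} → All (λ x → 0ℚ ≤ f x) xs → 0ℚ ≤ ∑ f xs
  ∑-nonNeg [] = ℚP.≤-refl
  ∑-nonNeg (0≤fx ∷ 0≤fxs) = ℚP.+-mono-≤ 0≤fx (∑-nonNeg 0≤fxs)

  ∑-nonNeg-≡0 : ∀ {f : A → ℚ} {xs} → All (λ x → 0ℚ ≤ f x) xs → ∑ f xs ≡ 0ℚ → All (λ x → f x ≡ 0ℚ) xs
  ∑-nonNeg-≡0 [] _ = []
  ∑-nonNeg-≡0 {f} {x ∷ xs} (0≤fx ∷ 0≤fxs) sum≡0 = fx≡0 ∷ ∑-nonNeg-≡0 0≤fxs rest≡0
    where
    fx≤0 : f x ≤ 0ℚ
    fx≤0 = begin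
      f x              ≡⟨ ℚP.+-identityʳ (f x) ⟨
      f x + 0ℚ         ≤⟨ ℚP.+-monoʳ-≤ (f x) (∑-nonNeg 0≤fxs) ⟩
      f x + ∑ f xs     ≡⟨ sum≡0 ⟩
      0ℚ               ∎
      where open ℚP.≤-Reasoning
    fx≡0 : f x ≡ 0ℚ
    fx≡0 = ℚP.≤-antisym fx≤0 0≤fx
    rest≡0 : ∑ f xs ≡ 0ℚ
    rest≡0 = trans (sym (ℚP.+-identityˡ _)) (trans (cong (_+ ∑ f xs) (sym fx≡0)) sum≡0)

module _ {A B : Set} where

  ∑-map : ∀ (f : B → ℚ) (h : A → B) xs → ∑ f (map h xs) ≡ ∑ (λ x → f (h x)) xs
  ∑-map f h [] = refl
  ∑-map f h (x ∷ xs) = cong (f (h x) +_) (∑-map f h xs)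

  ∑-concatMap : ∀ (f : B → ℚ) (h : A → List B) xs →
                ∑ f (L.concatMap h xs) ≡ ∑ (λ x → ∑ f (h x)) xs
  ∑-concatMap f h [] = refl
  ∑-concatMap f h (x ∷ xs) =
    trans (∑-++ f (h x) (L.concatMap h xs)) (cong (∑ f (h x) +_) (∑-concatMap f h xs))

  ∑∑-* : ∀ (xs : List A) (ys : List B) (a : A → ℚ) (b : B → ℚ) c →
         ∑ (λ x → ∑ (λ y → a x * b y * c) ys) xs ≡ ∑ a xs * ∑ b ys * c
  ∑∑-* xs ys a b c = begin
    ∑ (λ x → ∑ (λ y → a x * b y * c) ys) xs  ≡⟨ ∑-cong xs inner ⟩
    ∑ (λ x → a x * (∑ b ys * c)) xs          ≡⟨ ∑-*ʳ (∑ b ys * c) a xs ⟩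
    ∑ a xs * (∑ b ys * c)                    ≡⟨ ℚP.*-assoc (∑ a xs) (∑ b ys) c ⟨
    ∑ a xs * ∑ b ys * c                      ∎
    where
    open ≡-Reasoning
    inner : ∀ x → ∑ (λ y → a x * b y * c) ys ≡ a x * (∑ b ys * c)
    inner x = begin
      ∑ (λ y → a x * b y * c) ys    ≡⟨ ∑-cong ys (λ y → ℚP.*-assoc (a x) (b y) c) ⟩
      ∑ (λ y → a x * (b y * c)) ys  ≡⟨ ∑-*ˡ (a x) (λ y → b y * c) ys ⟩
      a x * ∑ (λ y → b y * c) ys    ≡⟨ cong (a x *_) (∑-*ʳ c b ys) ⟩
      a x * (∑ b ys * c)            ∎

-- Index zero of a point is its last coordinate β.
coord : ∀ {A : Set} {m} → Vector A m × A → Fin (suc m) → A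
coord (x , a) zero = a
coord (x , a) (suc i) = x i

fromCoords : ∀ {A : Set} {m} → (Fin (suc m) → A) → Vector A m × A
fromCoords f = (λ i → f (suc i)) , f zero

coord-fromCoords : ∀ {A : Set} {m} (f : Fin (suc m) → A) k → coord (fromCoords f) k ≡ f k
coord-fromCoords f zero = refl
coord-fromCoords f (suc i) = refl

scaleCoeffs : ∀ {B : Set} → ℚ → List (ℚ × B) → List (ℚ × B)
scaleCoeffs t = map (λ c → t * proj₁ c , proj₂ c)

module _ {m : ℕ} where

  _≐_ : QPt m → QPt m → Set
  p ≐ q = ∀ k → coord p k ≡ coord q k

  ≐-sym : ∀ {p q} → p ≐ q → q ≐ p
  ≐-sym p≐q k = sym (p≐q k)

  ≐-trans : ∀ {p q r} → p ≐ q → q ≐ r → p ≐ r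
  ≐-trans p≐q q≐r k = trans (p≐q k) (q≐r k)

  ≐⇒≈q : ∀ {p q} → p ≐ q → p ≈q q
  ≐⇒≈q p≐q = (λ i → p≐q (suc i)) , p≐q zero

  ≈q⇒≐ : ∀ {p q} → p ≈q q → p ≐ q
  ≈q⇒≐ (x≗y , a≡b) zero = a≡b
  ≈q⇒≐ (x≗y , a≡b) (suc i) = x≗y i

  coord⇒≈ᵖ : ∀ {p q : Pt m} → (∀ k → coord p k ≡ coord q k) → p ≈ᵖ q
  coord⇒≈ᵖ p≗q = (λ i → p≗q (suc i)) , p≗q zero

  ≈ᵖ-sym : ∀ {p q : Pt m} → p ≈ᵖ q → q ≈ᵖ p
  ≈ᵖ-sym (x≗y , a≡b) = (λ i → sym (x≗y i)) , sym a≡b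

  ≈ᵖ⇒coord : ∀ {p q : Pt m} → p ≈ᵖ q → ∀ k → coord p k ≡ coord q k
  ≈ᵖ⇒coord (x≗y , a≡b) zero = a≡b
  ≈ᵖ⇒coord (x≗y , a≡b) (suc i) = x≗y i

  coord-+ᵖ : ∀ (p q : Pt m) k → coord (p +ᵖ q) k ≡ coord p k ℤ.+ coord q k
  coord-+ᵖ p q zero = refl
  coord-+ᵖ p q (suc i) = refl

  coord-0ᵖ : ∀ k → coord (0ᵖ {m}) k ≡ ℤ.+ 0
  coord-0ᵖ zero = refl
  coord-0ᵖ (suc i) = refl

  coord-toQ : ∀ (p : Pt m) k → coord (toQ p) k ≡ ι (coord p k)
  coord-toQ p zero = refl
  coord-toQ p (suc i) = refl

  coord-+q : ∀ (p q : QPt m) k → coord (p +q q) k ≡ coord p k + coord q k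
  coord-+q p q zero = refl
  coord-+q p q (suc i) = refl

  coord-·q : ∀ t (p : QPt m) k → coord (t ·q p) k ≡ t * coord p k
  coord-·q t p zero = refl
  coord-·q t p (suc i) = refl

  coord-0q : ∀ k → coord (0q {m}) k ≡ 0ℚ
  coord-0q zero = refl
  coord-0q (suc i) = refl

  coord-lincomb : ∀ cs k → coord (lincomb {m} cs) k ≡ ∑ (λ c → proj₁ c * coord (proj₂ c) k) cs
  coord-lincomb [] k = coord-0q k
  coord-lincomb ((t , p) ∷ cs) k =
    trans (coord-+q (t ·q p) (lincomb cs) k) (cong₂ _+_ (coord-·q t p k) (coord-lincomb cs k))

  coord-lincomb-++ : ∀ cs ds k →
    coord (lincomb {m} (cs ++ ds)) k ≡ coord (lincomb cs) k + coord (lincomb ds) k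
  coord-lincomb-++ cs ds k = begin
    coord (lincomb (cs ++ ds)) k                  ≡⟨ coord-lincomb (cs ++ ds) k ⟩
    ∑ (F k) (cs ++ ds)                            ≡⟨ ∑-++ (F k) cs ds ⟩
    ∑ (F k) cs + ∑ (F k) ds                       ≡⟨ cong₂ _+_ (coord-lincomb cs k) (coord-lincomb ds k) ⟨
    coord (lincomb cs) k + coord (lincomb ds) k   ∎
    where
    open ≡-Reasoning
    F : Fin (suc m) → ℚ × QPt m → ℚ
    F k c = proj₁ c * coord (proj₂ c) k

  coord-lincomb-scale : ∀ t cs k → coord (lincomb {m} (scaleCoeffs t cs)) k ≡ t * coord (lincomb cs) k
  coord-lincomb-scale t cs k = begin
    coord (lincomb (scaleCoeffs t cs)) k                   ≡⟨ coord-lincomb (scaleCoeffs t cs) k ⟩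
    ∑ (λ c → proj₁ c * coord (proj₂ c) k) (scaleCoeffs t cs)  ≡⟨ ∑-map _ _ cs ⟩
    ∑ (λ c → t * proj₁ c * coord (proj₂ c) k) cs           ≡⟨ ∑-cong cs (λ c → ℚP.*-assoc t (proj₁ c) _) ⟩
    ∑ (λ c → t * (proj₁ c * coord (proj₂ c) k)) cs         ≡⟨ ∑-*ˡ t _ cs ⟩
    t * ∑ (λ c → proj₁ c * coord (proj₂ c) k) cs           ≡⟨ cong (t *_) (coord-lincomb cs k) ⟨
    t * coord (lincomb cs) k                               ∎
    where open ≡-Reasoning

  sumCoeffs≡∑ : ∀ cs → sumCoeffs {m} cs ≡ ∑ proj₁ cs
  sumCoeffs≡∑ [] = refl
  sumCoeffs≡∑ (c ∷ cs) = cong (proj₁ c +_) (sumCoeffs≡∑ cs)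

  toQᶜ : ℚ × Pt m → ℚ × QPt m
  toQᶜ c = proj₁ c , toQ (proj₂ c)

  coord-lincomb-toQ : ∀ cs k →
    coord (lincomb (map toQᶜ cs)) k ≡ ∑ (λ c → proj₁ c * ι (coord (proj₂ c) k)) cs
  coord-lincomb-toQ cs k =
    trans (coord-lincomb (map toQᶜ cs) k)
      (trans (∑-map _ toQᶜ cs) (∑-cong cs (λ c → cong (proj₁ c *_) (coord-toQ (proj₂ c) k))))

-- Cones and relative interiors

module _ {m : ℕ} {M : Pt m → Set} where

  Cone-resp : ∀ {y y'} → y ≐ y' → Cone M y → Cone M y'
  Cone-resp y≐y' (cs , cs∈ , y≈) = cs , cs∈ , ≐⇒≈q (≐-trans (≐-sym y≐y') (≈q⇒≐ y≈))

  Cone-zero : ∀ {y} → (∀ k → coord y k ≡ 0ℚ) → Cone M y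
  Cone-zero y≡0 = [] , [] , ≐⇒≈q (λ k → trans (y≡0 k) (sym (coord-0q k)))

  Cone-+ : ∀ {a b y} → Cone M a → Cone M b → (∀ k → coord y k ≡ coord a k + coord b k) → Cone M y
  Cone-+ {a} {b} {y} (cs , cs∈ , a≈) (ds , ds∈ , b≈) y≡a+b =
    cs ++ ds , Allₚ.++⁺ cs∈ ds∈ , ≐⇒≈q λ k → begin
      coord y k                                                 ≡⟨ y≡a+b k ⟩
      coord a k + coord b k                                     ≡⟨ cong₂ _+_ (≈q⇒≐ a≈ k) (≈q⇒≐ b≈ k) ⟩
      coord (lincomb (map toQᶜ cs)) k + coord (lincomb (map toQᶜ ds)) k
                                                                ≡⟨ coord-lincomb-++ (map toQᶜ cs) _ k ⟨
      coord (lincomb (map toQᶜ cs ++ map toQᶜ ds)) k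
        ≡⟨ cong (λ l → coord (lincomb l) k) (Lₚ.map-++ toQᶜ cs ds) ⟨
      coord (lincomb (map toQᶜ (cs ++ ds))) k                   ∎
    where open ≡-Reasoning

  Cone-* : ∀ {a y} t → 0ℚ ≤ t → Cone M a → (∀ k → coord y k ≡ t * coord a k) → Cone M y
  Cone-* {y = y} t 0≤t (cs , cs∈ , a≈) y≡ta =
    scaleCoeffs t cs , Allₚ.map⁺ (All.map scaled cs∈) , ≐⇒≈q λ k → begin
      coord y k                                                ≡⟨ y≡ta k ⟩
      _                                                        ≡⟨ cong (t *_) (≈q⇒≐ a≈ k) ⟩
      t * coord (lincomb (map toQᶜ cs)) k                      ≡⟨ cong (t *_) (coord-lincomb-toQ cs k) ⟩
      t * ∑ (λ c → proj₁ c * ι (coord (proj₂ c) k)) cs         ≡⟨ ∑-*ˡ t _ cs ⟨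
      ∑ (λ c → t * (proj₁ c * ι (coord (proj₂ c) k))) cs       ≡⟨ ∑-cong cs (λ c → ℚP.*-assoc t (proj₁ c) _) ⟨
      ∑ (λ c → t * proj₁ c * ι (coord (proj₂ c) k)) cs         ≡⟨ ∑-map _ _ cs ⟨
      ∑ (λ c → proj₁ c * ι (coord (proj₂ c) k)) (scaleCoeffs t cs)
                                                               ≡⟨ coord-lincomb-toQ (scaleCoeffs t cs) k ⟨
      coord (lincomb (map toQᶜ (scaleCoeffs t cs))) k          ∎
    where
    open ≡-Reasoning
    scaled : ∀ {c} → (0ℚ ≤ proj₁ c) × M (proj₂ c) → (0ℚ ≤ t * proj₁ c) × M (proj₂ c)
    scaled (0≤c , p∈M) = 0≤*0≤ 0≤t 0≤c , p∈M

  Cone-point : ∀ {p} → M p → Cone M (toQ p)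
  Cone-point {p} p∈M = (1ℚ , p) ∷ [] , (0≤1 , p∈M) ∷ [] , ≐⇒≈q λ k →
    sym (trans (coord-lincomb (toQᶜ (1ℚ , p) ∷ []) k) (trans (ℚP.+-identityʳ _) (ℚP.*-identityˡ _)))

  Cone-lincomb : ∀ cs → All (λ c → (0ℚ ≤ proj₁ c) × Cone M (proj₂ c)) cs → Cone M (lincomb cs)
  Cone-lincomb [] [] = Cone-zero coord-0q
  Cone-lincomb ((t , p) ∷ cs) ((0≤t , p∈C) ∷ cs∈C) =
    Cone-+ (Cone-* {y = t ·q p} t 0≤t p∈C (coord-·q t p)) (Cone-lincomb cs cs∈C) (coord-+q (t ·q p) (lincomb cs))

module _ {m : ℕ} {S : QPt m → Set} where

  AffHull-point : ∀ {y} → S y → AffHull S y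
  AffHull-point {y} y∈S = (1ℚ , y) ∷ [] , y∈S ∷ [] , refl , ≐⇒≈q λ k →
    sym (trans (coord-lincomb ((1ℚ , y) ∷ []) k) (trans (ℚP.+-identityʳ _) (ℚP.*-identityˡ _)))

  AffHull-+- : ∀ {a b c z} → AffHull S a → AffHull S b → AffHull S c →
               (∀ k → coord z k ≡ coord a k + coord b k - coord c k) → AffHull S z
  AffHull-+- {a} {b} {c} {z} (as , as∈ , Σas , a≈) (bs , bs∈ , Σbs , b≈) (cs , cs∈ , Σcs , c≈) z≡a+b-c =
    as ++ (bs ++ scaleCoeffs (- 1ℚ) cs) , Allₚ.++⁺ as∈ (Allₚ.++⁺ bs∈ (Allₚ.map⁺ cs∈)) , Σ≡1 ,
    ≐⇒≈q λ k → begin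
      coord z k                                             ≡⟨ z≡a+b-c k ⟩
      coord a k + coord b k - coord c k
        ≡⟨ cong₂ _-_ (cong₂ _+_ (≈q⇒≐ a≈ k) (≈q⇒≐ b≈ k)) (≈q⇒≐ c≈ k) ⟩
      A k + B k - C k                                       ≡⟨ a+b-c≡a+[b+[-1]c] (A k) (B k) (C k) ⟩
      A k + (B k + - 1ℚ * C k)
        ≡⟨ cong (λ u → A k + (B k + u)) (coord-lincomb-scale (- 1ℚ) cs k) ⟨
      A k + (B k + coord (lincomb (scaleCoeffs (- 1ℚ) cs)) k) ≡⟨ cong (A k +_) (coord-lincomb-++ bs _ k) ⟨
      A k + coord (lincomb (bs ++ scaleCoeffs (- 1ℚ) cs)) k  ≡⟨ coord-lincomb-++ as _ k ⟨
      coord (lincomb (as ++ (bs ++ scaleCoeffs (- 1ℚ) cs))) k ∎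
    where
    open ≡-Reasoning
    A B C : Fin (suc m) → ℚ
    A = coord (lincomb as)
    B = coord (lincomb bs)
    C = coord (lincomb cs)
    a+b-c≡a+[b+[-1]c] : ∀ x y w → x + y - w ≡ x + (y + - 1ℚ * w)
    a+b-c≡a+[b+[-1]c] = solve 3 (λ x y w → x :+ y :- w := x :+ (y :+ (:- con 1ℚ) :* w)) refl
      where open +-*-Solver
    Σ≡1 : sumCoeffs (as ++ (bs ++ scaleCoeffs (- 1ℚ) cs)) ≡ 1ℚ
    Σ≡1 = begin
      sumCoeffs (as ++ (bs ++ scaleCoeffs (- 1ℚ) cs))        ≡⟨ sumCoeffs≡∑ (as ++ (bs ++ scaleCoeffs (- 1ℚ) cs)) ⟩
      ∑ proj₁ (as ++ (bs ++ scaleCoeffs (- 1ℚ) cs))          ≡⟨ ∑-++ proj₁ as _ ⟩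
      ∑ proj₁ as + ∑ proj₁ (bs ++ scaleCoeffs (- 1ℚ) cs)     ≡⟨ cong (∑ proj₁ as +_) (∑-++ proj₁ bs _) ⟩
      ∑ proj₁ as + (∑ proj₁ bs + ∑ proj₁ (scaleCoeffs (- 1ℚ) cs))
        ≡⟨ cong (λ u → ∑ proj₁ as + (∑ proj₁ bs + u)) (trans (∑-map proj₁ _ cs) (∑-*ˡ (- 1ℚ) proj₁ cs)) ⟩
      ∑ proj₁ as + (∑ proj₁ bs + - 1ℚ * ∑ proj₁ cs)
        ≡⟨ cong₂ (λ x y → x + (y + - 1ℚ * ∑ proj₁ cs)) (Σ1 as Σas) (Σ1 bs Σbs) ⟩
      1ℚ + (1ℚ + - 1ℚ * ∑ proj₁ cs)                          ≡⟨ cong (λ u → 1ℚ + (1ℚ + - 1ℚ * u)) (Σ1 cs Σcs) ⟩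
      1ℚ + (1ℚ + - 1ℚ * 1ℚ)                                  ≡⟨⟩
      1ℚ                                                     ∎
      where
      Σ1 : ∀ ds → sumCoeffs ds ≡ 1ℚ → ∑ proj₁ ds ≡ 1ℚ
      Σ1 ds Σds = trans (sym (sumCoeffs≡∑ ds)) Σds

module _ {m : ℕ} where

  Near⇒coord : ∀ {ε} {p q : QPt m} → Near ε p q → ∀ k → ∣ coord q k - coord p k ∣ < ε
  Near⇒coord (near-x , near-a) zero = near-a
  Near⇒coord (near-x , near-a) (suc i) = near-x i

  coord⇒Near : ∀ {ε} {p q : QPt m} → (∀ k → ∣ coord q k - coord p k ∣ < ε) → Near ε p q
  coord⇒Near near = (λ i → near (suc i)) , near zero

  Near-mono : ∀ {ε ε'} {p q : QPt m} → ε ≤ ε' → Near ε p q → Near ε' p q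
  Near-mono {p = p} {q} ε≤ε' near = coord⇒Near {p = p} {q} λ k → ℚP.<-≤-trans (Near⇒coord {p = p} {q} near k) ε≤ε'

-- Restrictions to, and extensions by zero from, the edge spaces of G₁ and G₂ are of this form.
IsCoordinateMap : ∀ {m m'} → (QPt m → QPt m') → Set
IsCoordinateMap {m} {m'} f = ∀ (k : Fin (suc m')) →
  (∃ λ j → ∀ z → coord (f z) k ≡ coord z j) ⊎ (∀ z → coord (f z) k ≡ 0ℚ)

module _ {m m' : ℕ} {f : QPt m → QPt m'} (f-coord : IsCoordinateMap f) where

  private
    mapᶜ : ℚ × QPt m → ℚ × QPt m'
    mapᶜ c = proj₁ c , f (proj₂ c)

  coordMap-resp : ∀ {z z'} → z ≐ z' → f z ≐ f z'
  coordMap-resp {z} {z'} z≐z' k with f-coord k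
  ... | inj₁ (j , fk≡j) = trans (fk≡j z) (trans (z≐z' j) (sym (fk≡j z')))
  ... | inj₂ fk≡0 = trans (fk≡0 z) (sym (fk≡0 z'))

  coordMap-lincomb : ∀ cs → f (lincomb cs) ≐ lincomb (map mapᶜ cs)
  coordMap-lincomb cs k with f-coord k
  ... | inj₁ (j , fk≡j) = begin
    coord (f (lincomb cs)) k                         ≡⟨ fk≡j (lincomb cs) ⟩
    coord (lincomb cs) j                             ≡⟨ coord-lincomb cs j ⟩
    ∑ (λ c → proj₁ c * coord (proj₂ c) j) cs         ≡⟨ ∑-cong cs (λ c → cong (proj₁ c *_) (fk≡j (proj₂ c))) ⟨
    ∑ (λ c → proj₁ c * coord (f (proj₂ c)) k) cs     ≡⟨ ∑-map _ mapᶜ cs ⟨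
    ∑ (λ c → proj₁ c * coord (proj₂ c) k) (map mapᶜ cs) ≡⟨ coord-lincomb (map mapᶜ cs) k ⟨
    coord (lincomb (map mapᶜ cs)) k                  ∎
    where open ≡-Reasoning
  ... | inj₂ fk≡0 = begin
    coord (f (lincomb cs)) k                         ≡⟨ fk≡0 (lincomb cs) ⟩
    0ℚ                                               ≡⟨ ∑-0 cs ⟨
    ∑ (λ _ → 0ℚ) cs
      ≡⟨ ∑-cong cs (λ c → trans (cong (proj₁ c *_) (fk≡0 (proj₂ c))) (ℚP.*-zeroʳ (proj₁ c))) ⟨
    ∑ (λ c → proj₁ c * coord (f (proj₂ c)) k) cs     ≡⟨ ∑-map _ mapᶜ cs ⟨
    ∑ (λ c → proj₁ c * coord (proj₂ c) k) (map mapᶜ cs) ≡⟨ coord-lincomb (map mapᶜ cs) k ⟨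
    coord (lincomb (map mapᶜ cs)) k                  ∎
    where open ≡-Reasoning

  AffHull-map : ∀ {S : QPt m → Set} {S' : QPt m' → Set} → (∀ z → S z → S' (f z)) →
                ∀ {z} → AffHull S z → AffHull S' (f z)
  AffHull-map f[S]⊆S' (cs , cs∈ , Σcs , z≈) =
    map mapᶜ cs , Allₚ.map⁺ (All.map (f[S]⊆S' _) cs∈) ,
    trans (sumCoeffs≡∑ (map mapᶜ cs)) (trans (∑-map proj₁ mapᶜ cs) (trans (sym (sumCoeffs≡∑ cs)) Σcs)) ,
    ≐⇒≈q (≐-trans (coordMap-resp (≈q⇒≐ z≈)) (coordMap-lincomb cs))

  Cone-map : ∀ {M : Pt m → Set} {M' : Pt m' → Set} → (∀ p → M p → Cone M' (f (toQ p))) →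
             ∀ {z} → Cone M z → Cone M' (f z)
  Cone-map {M} {M'} f[M]⊆C' (cs , cs∈ , z≈) =
    Cone-resp (≐-sym f[z]≐) (Cone-lincomb (map (λ c → proj₁ c , f (toQ (proj₂ c))) cs)
      (Allₚ.map⁺ (All.map (λ (0≤c , p∈M) → 0≤c , f[M]⊆C' _ p∈M) cs∈)))
    where
    f[z]≐ : f _ ≐ lincomb (map (λ c → proj₁ c , f (toQ (proj₂ c))) cs)
    f[z]≐ = ≐-trans (coordMap-resp (≈q⇒≐ z≈)) (≐-trans (coordMap-lincomb (map toQᶜ cs))
              (λ k → cong (λ l → coord (lincomb l) k) (sym (Lₚ.map-∘ cs))))

  Near-map : ∀ {ε p q} → 0ℚ < ε → Near ε p q → Near ε (f p) (f q)
  Near-map {ε} {p} {q} 0<ε near = coord⇒Near {p = f p} {q = f q} near-f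
    where
    near-f : ∀ k → ∣ coord (f q) k - coord (f p) k ∣ < ε
    near-f k with f-coord k
    ... | inj₁ (j , fk≡j) rewrite fk≡j q | fk≡j p = Near⇒coord near j
    ... | inj₂ fk≡0 rewrite fk≡0 q | fk≡0 p = 0<ε

module _ {m : ℕ} {M : Pt m → Set} where

  RelInt-resp : ∀ {p p'} → p ≐ p' → RelInt (Cone M) p → RelInt (Cone M) p'
  RelInt-resp {p} {p'} p≐p' (p∈C , ε , 0<ε , ball) =
    Cone-resp p≐p' p∈C , ε , 0<ε , λ z z∈A near → ball z z∈A (coord⇒Near {p = p} {z} λ k →
      subst (λ u → ∣ coord z k - u ∣ < ε) (sym (p≐p' k)) (Near⇒coord {p = p'} {z} near k))

  RelInt-+Cone : ∀ {s c y} → RelInt (Cone M) s → Cone M c →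
                 (∀ k → coord y k ≡ coord s k + coord c k) → RelInt (Cone M) y
  RelInt-+Cone {s} {c} {y} (s∈C , ε , 0<ε , ball) c∈C y≡s+c =
    Cone-+ s∈C c∈C y≡s+c , ε , 0<ε , λ z z∈A near →
      Cone-+ (ball (z-c z) (z-c∈A z∈A) (z-c-near {z} near)) c∈C (z≡[z-c]+c z)
    where
    open +-*-Solver
    z-c-coords : QPt m → Fin (suc m) → ℚ
    z-c-coords z k = coord z k + 0ℚ - coord c k

    z-c : QPt m → QPt m
    z-c z = fromCoords (z-c-coords z)

    z-c∈A : ∀ {z} → AffHull (Cone M) z → AffHull (Cone M) (z-c z)
    z-c∈A {z} z∈A = AffHull-+- z∈A (AffHull-point {y = 0q} (Cone-zero coord-0q)) (AffHull-point c∈C)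
      λ k → trans (coord-fromCoords (z-c-coords z) k) (cong (λ u → coord z k + u - coord c k) (sym (coord-0q k)))

    z-c-near : ∀ {z} → Near ε y z → Near ε s (z-c z)
    z-c-near {z} near = coord⇒Near {p = s} {z-c z} λ k → subst (_< ε) (cong ∣_∣ (sym (begin
      coord (z-c z) k - coord s k                  ≡⟨ cong (_- coord s k) (coord-fromCoords (z-c-coords z) k) ⟩
      coord z k + 0ℚ - coord c k - coord s k       ≡⟨ shuffle (coord z k) (coord c k) (coord s k) ⟩
      coord z k - (coord s k + coord c k)          ≡⟨ cong (λ u → coord z k - u) (y≡s+c k) ⟨
      coord z k - coord y k                        ∎))) (Near⇒coord {p = y} {z} near k)
      where
      open ≡-Reasoning
      shuffle : ∀ a b c → a + 0ℚ - b - c ≡ a - (c + b)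
      shuffle = solve 3 (λ a b c → a :+ con 0ℚ :- b :- c := a :- (c :+ b)) refl

    z≡[z-c]+c : ∀ z k → coord z k ≡ coord (z-c z) k + coord c k
    z≡[z-c]+c z k =
      trans (shuffle (coord z k) (coord c k)) (cong (_+ coord c k) (sym (coord-fromCoords (z-c-coords z) k)))
      where
      shuffle : ∀ a b → a ≡ a + 0ℚ - b + b
      shuffle = solve 2 (λ a b → a := a :+ con 0ℚ :- b :+ b) refl

module _ {m m₁ : ℕ} {M : Pt m → Set} {M₁ : Pt m₁ → Set}
         {f : QPt m → QPt m₁} {g : QPt m₁ → QPt m} (f-coord : IsCoordinateMap f) (g-coord : IsCoordinateMap g)
         (f-cone : ∀ {z} → Cone M z → Cone M₁ (f z)) (g-cone : ∀ {z} → Cone M₁ z → Cone M (g z))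
         (f∘g≐id : ∀ z → f (g z) ≐ z) where

  RelInt-retraction : ∀ {p} → RelInt (Cone M) p → RelInt (Cone M₁) (f p)
  RelInt-retraction {p} (p∈C , ε , 0<ε , ball) = f-cone p∈C , ε , 0<ε , λ z z∈A near →
    Cone-resp (f[lift]≐ z) (f-cone (ball (lift z) (lift∈A z∈A) (lift-near near)))
    where
    open ≡-Reasoning
    -- the translate of g z by p - g (f p); it lies over z
    lift-coords : QPt m₁ → Fin (suc m) → ℚ
    lift-coords z k = coord p k + coord (g z) k - coord (g (f p)) k

    lift : QPt m₁ → QPt m
    lift z = fromCoords (lift-coords z)

    lift∈A : ∀ {z} → AffHull (Cone M₁) z → AffHull (Cone M) (lift z)
    lift∈A z∈A = AffHull-+- (AffHull-point p∈C) (AffHull-map g-coord (λ _ → g-cone) z∈A)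
                   (AffHull-point (g-cone (f-cone p∈C))) (coord-fromCoords (lift-coords _))

    lift-near : ∀ {z} → Near ε (f p) z → Near ε p (lift z)
    lift-near {z} near = coord⇒Near {p = p} {lift z} λ k → subst (_< ε) (cong ∣_∣ (sym (begin
      coord (lift z) k - coord p k                      ≡⟨ cong (_- coord p k) (coord-fromCoords (lift-coords z) k) ⟩
      coord p k + coord (g z) k - coord (g (f p)) k - coord p k
                                                        ≡⟨ shuffle (coord p k) (coord (g z) k) _ ⟩
      coord (g z) k - coord (g (f p)) k                 ∎)))
      (Near⇒coord {p = g (f p)} {g z} (Near-map g-coord {p = f p} {q = z} 0<ε near) k)
      where
      shuffle : ∀ a b c → a + b - c - a ≡ b - c
      shuffle = solve 3 (λ a b c → a :+ b :- c :- a := b :- c) refl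
        where open +-*-Solver

    f[lift]≐ : ∀ z → f (lift z) ≐ z
    f[lift]≐ z k with f-coord k
    ... | inj₁ (j , fk≡j) = begin
      coord (f (lift z)) k                                ≡⟨ fk≡j (lift z) ⟩
      coord (lift z) j                                    ≡⟨ coord-fromCoords (lift-coords z) j ⟩
      coord p j + coord (g z) j - coord (g (f p)) j
        ≡⟨ cong₂ (λ u w → coord p j + u - w) (fk≡j (g z)) (fk≡j (g (f p))) ⟨
      coord p j + coord (f (g z)) k - coord (f (g (f p))) k
        ≡⟨ cong₂ (λ u w → coord p j + u - w) (f∘g≐id z k) (trans (f∘g≐id (f p) k) (fk≡j p)) ⟩
      coord p j + coord z k - coord p j                   ≡⟨ cancel (coord p j) (coord z k) ⟩
      coord z k                                           ∎
      where
      cancel : ∀ a b → a + b - a ≡ b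
      cancel = solve 2 (λ a b → a :+ b :- a := b) refl
        where open +-*-Solver
    ... | inj₂ fk≡0 = trans (fk≡0 (lift z)) (trans (sym (fk≡0 (g z))) (f∘g≐id z k))

module _ {m m₁ m₂ : ℕ} {M : Pt m → Set} {M₁ : Pt m₁ → Set} {M₂ : Pt m₂ → Set}
         {f₁ : QPt m → QPt m₁} {f₂ : QPt m → QPt m₂} (f₁-coord : IsCoordinateMap f₁) (f₂-coord : IsCoordinateMap f₂)
         (f₁-cone : ∀ {z} → Cone M z → Cone M₁ (f₁ z)) (f₂-cone : ∀ {z} → Cone M z → Cone M₂ (f₂ z))
         (fibre : ∀ {z} → Cone M₁ (f₁ z) → Cone M₂ (f₂ z) → Cone M z) where

  RelInt-fibre : ∀ {y} → Cone M y → RelInt (Cone M₁) (f₁ y) → RelInt (Cone M₂) (f₂ y) → RelInt (Cone M) y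
  RelInt-fibre {y} y∈C (_ , ε₁ , 0<ε₁ , ball₁) (_ , ε₂ , 0<ε₂ , ball₂) =
    y∈C , ε₁ ℚ.⊓ ε₂ , 0<ε , λ z z∈A near → fibre
      (ball₁ (f₁ z) (AffHull-map f₁-coord (λ _ → f₁-cone) z∈A)
        (Near-map f₁-coord {p = y} {q = z} 0<ε₁ (Near-mono {p = y} {z} (ℚP.p⊓q≤p ε₁ ε₂) near)))
      (ball₂ (f₂ z) (AffHull-map f₂-coord (λ _ → f₂-cone) z∈A)
        (Near-map f₂-coord {p = y} {q = z} 0<ε₂ (Near-mono {p = y} {z} (ℚP.p⊓q≤q ε₁ ε₂) near)))
    where
    0<ε : 0ℚ < ε₁ ℚ.⊓ ε₂
    0<ε with ℚP.⊓-sel ε₁ ε₂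
    ... | inj₁ ε₁⊓ε₂≡ε₁ rewrite ε₁⊓ε₂≡ε₁ = 0<ε₁
    ... | inj₂ ε₁⊓ε₂≡ε₂ rewrite ε₁⊓ε₂≡ε₂ = 0<ε₂

-- The cut monoid

module _ {n} (H : Graph n) where

  cutPt : Subset n → Pt (length (E H))
  cutPt A = δ H A , ℤ.+ 1

  cutSum : List (Subset n) → Pt (length (E H))
  cutSum As = sumᵖ (map cutPt As)

  cutSum-last : ∀ As → proj₂ (cutSum As) ≡ ℤ.+ length As
  cutSum-last [] = refl
  cutSum-last (A ∷ As) = cong (λ u → ℤ.+ 1 ℤ.+ u) (cutSum-last As)

  cutSum-++ : ∀ As Bs k → coord (cutSum (As ++ Bs)) k ≡ coord (cutSum As) k ℤ.+ coord (cutSum Bs) k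
  cutSum-++ [] Bs k = trans (sym (ℤP.+-identityˡ _)) (cong (ℤ._+ coord (cutSum Bs) k) (sym (coord-0ᵖ k)))
  cutSum-++ (A ∷ As) Bs k = begin
    coord (cutPt A +ᵖ cutSum (As ++ Bs)) k                        ≡⟨ coord-+ᵖ (cutPt A) (cutSum (As ++ Bs)) k ⟩
    coord (cutPt A) k ℤ.+ coord (cutSum (As ++ Bs)) k
      ≡⟨ cong (λ u → coord (cutPt A) k ℤ.+ u) (cutSum-++ As Bs k) ⟩
    coord (cutPt A) k ℤ.+ (coord (cutSum As) k ℤ.+ coord (cutSum Bs) k)
                                                                  ≡⟨ ℤP.+-assoc (coord (cutPt A) k) _ _ ⟨
    coord (cutPt A) k ℤ.+ coord (cutSum As) k ℤ.+ coord (cutSum Bs) k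
      ≡⟨ cong (ℤ._+ coord (cutSum Bs) k) (coord-+ᵖ (cutPt A) (cutSum As) k) ⟨
    coord (cutPt A +ᵖ cutSum As) k ℤ.+ coord (cutSum Bs) k        ∎
    where open ≡-Reasoning

  MG-last : ∀ {p} (p∈M : MG H p) → proj₂ p ≡ ℤ.+ length (proj₁ p∈M)
  MG-last (As , _ , p≈) = trans (proj₂ p≈) (cutSum-last As)

  MG-resp : ∀ {p q} → p ≈ᵖ q → MG H p → MG H q
  MG-resp (x≗y , a≡b) (As , As⊆V , (x≗ , a≡)) = As , As⊆V , (λ i → trans (sym (x≗y i)) (x≗ i)) , trans (sym a≡b) a≡

  MG-cutSum : ∀ {As} → All (_⊆ V H) As → MG H (cutSum As)
  MG-cutSum {As} As⊆V = As , As⊆V , (λ i → refl) , refl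

  MG-cut : ∀ {A} → A ⊆ V H → MG H (cutPt A)
  MG-cut A⊆V = _ ∷ [] , A⊆V ∷ [] , (λ i → sym (ℤP.+-identityʳ _)) , refl

  MG-+ : ∀ {p q} → MG H p → MG H q → MG H (p +ᵖ q)
  MG-+ {p} {q} (As , As⊆V , p≈) (Bs , Bs⊆V , q≈) = As ++ Bs , Allₚ.++⁺ As⊆V Bs⊆V , coord⇒≈ᵖ λ k →
    trans (coord-+ᵖ p q k) (trans (cong₂ ℤ._+_ (≈ᵖ⇒coord p≈ k) (≈ᵖ⇒coord q≈ k)) (sym (cutSum-++ As Bs k)))

  MG-zero : ∀ k → MG H ((λ _ → ℤ.+ 0) , ℤ.+ k)
  MG-zero k = replicate k Sub.⊥ , Allₚ.replicate⁺ k (λ {x} → Subₚ.⊥⊆ {x = x}) ,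
    (λ i → sym (empty-cuts k i)) , sym (trans (cutSum-last (replicate k Sub.⊥)) (cong ℤ.+_ (Lₚ.length-replicate k)))
    where
    empty-cuts : ∀ k i → proj₁ (cutSum (replicate k Sub.⊥)) i ≡ ℤ.+ 0
    empty-cuts zero i = refl
    empty-cuts (suc k) i rewrite Vecₚ.lookup-replicate (proj₁ (L.lookup (E H) i)) false
                               | Vecₚ.lookup-replicate (proj₂ (L.lookup (E H) i)) false =
      trans (ℤP.+-identityˡ _) (empty-cuts k i)

  MG-split : ∀ {q} (q∈M : MG H q) k → k ℕ.≤ length (proj₁ q∈M) →
             ∃₂ λ q' q'' → MG H q' × MG H q'' × proj₂ q' ≡ ℤ.+ k × q ≈ᵖ (q' +ᵖ q'')
  MG-split {q} (As , As⊆V , q≈) k k≤ =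
    cutSum (take k As) , cutSum (drop k As) ,
    MG-cutSum (Allₚ.take⁺ k As⊆V) , MG-cutSum (Allₚ.drop⁺ k As⊆V) ,
    trans (cutSum-last (take k As)) (cong ℤ.+_ (trans (Lₚ.length-take k As) (ℕP.m≤n⇒m⊓n≡m k≤))) ,
    coord⇒≈ᵖ λ j → begin
      coord q j                                              ≡⟨ ≈ᵖ⇒coord q≈ j ⟩
      coord (cutSum As) j
        ≡⟨ cong (λ l → coord (cutSum l) j) (Lₚ.take++drop≡id k As) ⟨
      coord (cutSum (take k As ++ drop k As)) j              ≡⟨ cutSum-++ (take k As) (drop k As) j ⟩
      coord (cutSum (take k As)) j ℤ.+ coord (cutSum (drop k As)) j
                                                             ≡⟨ coord-+ᵖ (cutSum (take k As)) (cutSum (drop k As)) j ⟨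
      coord (cutSum (take k As) +ᵖ cutSum (drop k As)) j     ∎
    where open ≡-Reasoning

module _ {n} (H : Graph n) where

  cutTerm : ℚ × Subset n → ℚ × QPt (length (E H))
  cutTerm d = proj₁ d , toQ (cutPt H (proj₂ d))

  CutCombination : QPt (length (E H)) → Set
  CutCombination w = ∃ λ (ds : List (ℚ × Subset n)) →
    All (λ d → (0ℚ ≤ proj₁ d) × (proj₂ d ⊆ V H)) ds × (w ≐ lincomb (map cutTerm ds))

  coord-cutCombination : ∀ ds k →
    coord (lincomb (map cutTerm ds)) k ≡ ∑ (λ d → proj₁ d * ι (coord (cutPt H (proj₂ d)) k)) ds
  coord-cutCombination ds k = trans (coord-lincomb (map cutTerm ds) k)
    (trans (∑-map _ cutTerm ds) (∑-cong ds (λ d → cong (proj₁ d *_) (coord-toQ (cutPt H (proj₂ d)) k))))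

  ι-cutSum : ∀ As k → ι (coord (cutSum H As) k) ≡ ∑ (λ A → ι (coord (cutPt H A) k)) As
  ι-cutSum [] k = cong ι (coord-0ᵖ k)
  ι-cutSum (A ∷ As) k = begin
    ι (coord (cutPt H A +ᵖ cutSum H As) k)                   ≡⟨ cong ι (coord-+ᵖ (cutPt H A) (cutSum H As) k) ⟩
    ι (coord (cutPt H A) k ℤ.+ coord (cutSum H As) k)        ≡⟨ ι-homo-+ (coord (cutPt H A) k) _ ⟩
    ι (coord (cutPt H A) k) + ι (coord (cutSum H As) k)      ≡⟨ cong (ι (coord (cutPt H A) k) +_) (ι-cutSum As k) ⟩
    ι (coord (cutPt H A) k) + ∑ (λ A → ι (coord (cutPt H A) k)) As ∎
    where open ≡-Reasoning

  private
    F : Fin (suc (length (E H))) → ℚ × Subset n → ℚ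
    F k d = proj₁ d * ι (coord (cutPt H (proj₂ d)) k)

  expandCuts : ∀ cs → All (λ c → (0ℚ ≤ proj₁ c) × MG H (proj₂ c)) cs →
               ∃ λ ds → All (λ d → (0ℚ ≤ proj₁ d) × (proj₂ d ⊆ V H)) ds ×
                        (lincomb (map toQᶜ cs) ≐ lincomb (map cutTerm ds))
  expandCuts [] [] = [] , [] , λ k → refl
  expandCuts ((t , p) ∷ cs) ((0≤t , (As , As⊆V , p≈)) ∷ cs∈) with expandCuts cs cs∈
  ... | ds , ds∈ , cs≐ds = tAs ++ ds , Allₚ.++⁺ (Allₚ.map⁺ (All.map (0≤t ,_) As⊆V)) ds∈ , λ k → begin
    coord ((t ·q toQ p) +q lincomb (map toQᶜ cs)) k       ≡⟨ coord-+q (t ·q toQ p) _ k ⟩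
    coord (t ·q toQ p) k + coord (lincomb (map toQᶜ cs)) k
      ≡⟨ cong₂ _+_ (trans (coord-·q t (toQ p) k) (cong (t *_) (coord-toQ p k))) (cs≐ds k) ⟩
    t * ι (coord p k) + coord (lincomb (map cutTerm ds)) k
      ≡⟨ cong₂ _+_ (cong (λ u → t * ι u) (≈ᵖ⇒coord p≈ k)) (coord-cutCombination ds k) ⟩
    t * ι (coord (cutSum H As) k) + ∑ (F k) ds            ≡⟨ cong (λ u → t * u + ∑ (F k) ds) (ι-cutSum As k) ⟩
    t * ∑ (λ A → ι (coord (cutPt H A) k)) As + ∑ (F k) ds
      ≡⟨ cong (_+ ∑ (F k) ds) (trans (∑-map (F k) (t ,_) As) (∑-*ˡ t _ As)) ⟨
    ∑ (F k) tAs + ∑ (F k) ds                              ≡⟨ ∑-++ (F k) tAs ds ⟨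
    ∑ (F k) (tAs ++ ds)                                   ≡⟨ coord-cutCombination (tAs ++ ds) k ⟨
    coord (lincomb (map cutTerm (tAs ++ ds))) k           ∎
    where
    open ≡-Reasoning
    tAs = map (t ,_) As

  CutCombination⇒Cone : ∀ {w} → CutCombination w → Cone (MG H) w
  CutCombination⇒Cone (ds , ds∈ , w≐) =
    map (λ d → proj₁ d , cutPt H (proj₂ d)) ds , Allₚ.map⁺ (All.map (λ (0≤d , A⊆V) → 0≤d , MG-cut H A⊆V) ds∈) ,
    ≐⇒≈q (≐-trans w≐ (λ k → cong (λ l → coord (lincomb l) k) (Lₚ.map-∘ ds)))

  Cone⇒CutCombination : ∀ {w} → Cone (MG H) w → CutCombination w
  Cone⇒CutCombination (cs , cs∈ , w≈) with expandCuts cs cs∈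
  ... | ds , ds∈ , cs≐ds = ds , ds∈ , ≐-trans (≈q⇒≐ w≈) cs≐ds

-- The 0-sum

-- m is the length of an edge list xs ++ ys, only propositionally equal to n₁ + n₂.
module EdgeSplit {n₁ n₂ m : ℕ} (m≡ : m ≡ n₁ ℕ.+ n₂) where

  side : Fin m → Fin n₁ ⊎ Fin n₂
  side j = splitAt n₁ (cast m≡ j)

  left : Fin n₁ → Fin m
  left i = cast (sym m≡) (i ↑ˡ n₂)

  right : Fin n₂ → Fin m
  right i = cast (sym m≡) (n₁ ↑ʳ i)

  side-left : ∀ i → side (left i) ≡ inj₁ i
  side-left i = trans (cong (splitAt n₁) (Fₚ.cast-involutive m≡ (sym m≡) (i ↑ˡ n₂))) (Fₚ.splitAt-↑ˡ n₁ i n₂)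

  side-right : ∀ i → side (right i) ≡ inj₂ i
  side-right i = trans (cong (splitAt n₁) (Fₚ.cast-involutive m≡ (sym m≡) (n₁ ↑ʳ i))) (Fₚ.splitAt-↑ʳ n₁ n₂ i)

  left-side : ∀ {j i} → side j ≡ inj₁ i → left i ≡ j
  left-side {j} side≡ = trans (cong (cast (sym m≡)) (Fₚ.splitAt⁻¹-↑ˡ side≡)) (Fₚ.cast-involutive (sym m≡) m≡ j)

  right-side : ∀ {j i} → side j ≡ inj₂ i → right i ≡ j
  right-side {j} side≡ = trans (cong (cast (sym m≡)) (Fₚ.splitAt⁻¹-↑ʳ side≡)) (Fₚ.cast-involutive (sym m≡) m≡ j)

  module _ {A : Set} where

    join : Vector A n₁ → Vector A n₂ → Vector A m
    join x y j = (x VF.++ y) (cast m≡ j)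

    join-left : ∀ (x : Vector A n₁) (y : Vector A n₂) i → join x y (left i) ≡ x i
    join-left x y i = cong [ x , y ]′ (side-left i)

    join-right : ∀ (x : Vector A n₁) (y : Vector A n₂) i → join x y (right i) ≡ y i
    join-right x y i = cong [ x , y ]′ (side-right i)

    join-restrict : ∀ (z : Vector A m) j → join (λ i → z (left i)) (λ i → z (right i)) j ≡ z j
    join-restrict z j with side j in side≡
    ... | inj₁ i = cong z (left-side side≡)
    ... | inj₂ i = cong z (right-side side≡)

    join-cong : ∀ {x x' : Vector A n₁} {y y' : Vector A n₂} →
                (∀ i → x i ≡ x' i) → (∀ i → y i ≡ y' i) → ∀ j → join x y j ≡ join x' y' j
    join-cong x≗x' y≗y' j = Sumₚ.[,]-cong x≗x' y≗y' (side j)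

    join-const : ∀ (c : A) j → join (λ _ → c) (λ _ → c) j ≡ c
    join-const c j = [,]-const (side j)
      where
      [,]-const : ∀ s → [ (λ _ → c) , (λ _ → c) ]′ s ≡ c
      [,]-const (inj₁ _) = refl
      [,]-const (inj₂ _) = refl

    restrictˡ : Vector A m × A → Vector A n₁ × A
    restrictˡ (z , a) = (λ i → z (left i)) , a

    restrictʳ : Vector A m × A → Vector A n₂ × A
    restrictʳ (z , a) = (λ i → z (right i)) , a

    extendˡ : A → Vector A n₁ × A → Vector A m × A
    extendˡ o (x , a) = join x (λ _ → o) , a

    extendʳ : A → Vector A n₂ × A → Vector A m × A
    extendʳ o (y , a) = join (λ _ → o) y , a

  join-map : ∀ {A B : Set} (f : A → B) (x : Vector A n₁) (y : Vector A n₂) j →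
             f (join x y j) ≡ join (λ i → f (x i)) (λ i → f (y i)) j
  join-map f x y j = Sumₚ.[,]-∘ f (side j)

  join-zipWith : ∀ {A B C : Set} (_∙_ : A → B → C) (x : Vector A n₁) (y : Vector A n₂) x' y' j →
                 join x y j ∙ join x' y' j ≡ join (λ i → x i ∙ x' i) (λ i → y i ∙ y' i) j
  join-zipWith _∙_ x y x' y' j = [,]-zipWith (side j)
    where
    [,]-zipWith : ∀ s → [ x , y ]′ s ∙ [ x' , y' ]′ s ≡ [ (λ i → x i ∙ x' i) , (λ i → y i ∙ y' i) ]′ s
    [,]-zipWith (inj₁ _) = refl
    [,]-zipWith (inj₂ _) = refl

  restrictˡ-coord : IsCoordinateMap (restrictˡ {ℚ})
  restrictˡ-coord zero = inj₁ (zero , λ z → refl)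
  restrictˡ-coord (suc i) = inj₁ (suc (left i) , λ z → refl)

  restrictʳ-coord : IsCoordinateMap (restrictʳ {ℚ})
  restrictʳ-coord zero = inj₁ (zero , λ z → refl)
  restrictʳ-coord (suc i) = inj₁ (suc (right i) , λ z → refl)

  extendˡ-coord : IsCoordinateMap (extendˡ 0ℚ)
  extendˡ-coord zero = inj₁ (zero , λ z → refl)
  extendˡ-coord (suc j) with side j
  ... | inj₁ i = inj₁ (suc i , λ z → refl)
  ... | inj₂ i = inj₂ (λ z → refl)

  extendʳ-coord : IsCoordinateMap (extendʳ 0ℚ)
  extendʳ-coord zero = inj₁ (zero , λ z → refl)
  extendʳ-coord (suc j) with side j
  ... | inj₁ i = inj₂ (λ z → refl)
  ... | inj₂ i = inj₁ (suc i , λ z → refl)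

  restrictˡ∘extendˡ : ∀ (z : QPt n₁) → restrictˡ (extendˡ 0ℚ z) ≐ z
  restrictˡ∘extendˡ z zero = refl
  restrictˡ∘extendˡ z (suc i) = join-left (proj₁ z) (λ _ → 0ℚ) i

  restrictʳ∘extendʳ : ∀ (z : QPt n₂) → restrictʳ (extendʳ 0ℚ z) ≐ z
  restrictʳ∘extendʳ z zero = refl
  restrictʳ∘extendʳ z (suc i) = join-right (λ _ → 0ℚ) (proj₁ z) i

lookup-++ : ∀ {A : Set} (xs ys : List A) j →
            L.lookup (xs ++ ys) j ≡ EdgeSplit.join (length-++ xs) (L.lookup xs) (L.lookup ys) j
lookup-++ [] ys j = cong (L.lookup ys) (sym (Fₚ.cast-is-id refl j))
lookup-++ (x ∷ xs) ys zero = refl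
lookup-++ (x ∷ xs) ys (suc j) with splitAt (length xs) (cast (length-++ xs) j) | lookup-++ xs ys j
... | inj₁ i | lookup≡ = lookup≡
... | inj₂ i | lookup≡ = lookup≡

δᵉ : ∀ {n} → Subset n → Fin n × Fin n → ℤ
δᵉ A e = if lookup A (proj₁ e) xor lookup A (proj₂ e) then ℤ.+ 1 else ℤ.+ 0

δᵉ-cong : ∀ {n} {A B : Subset n} e → lookup A (proj₁ e) ≡ lookup B (proj₁ e) →
          lookup A (proj₂ e) ≡ lookup B (proj₂ e) → δᵉ A e ≡ δᵉ B e
δᵉ-cong e A≡B₁ A≡B₂ rewrite A≡B₁ | A≡B₂ = refl

endpoints∈V : ∀ {n} {H : Graph n} → IsSimple H → ∀ i →
              lookup (V H) (proj₁ (L.lookup (E H) i)) ≡ true × lookup (V H) (proj₂ (L.lookup (E H) i)) ≡ true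
endpoints∈V (ends , _) i with All.lookup ends (∈-lookup i)
... | u∈V , w∈V , _ = Vecₚ.[]=⇒lookup u∈V , Vecₚ.[]=⇒lookup w∈V

lookup-∩ : ∀ {n} (A U : Subset n) {u} → lookup U u ≡ true → lookup (A ∩ U) u ≡ lookup A u
lookup-∩ A U {u} u∈U = trans (Vecₚ.lookup-zipWith _∧_ u A U) (trans (cong (lookup A u ∧_) u∈U) (Boolₚ.∧-identityʳ _))

module _ {n} {H G : Graph n} (simple : IsSimple H) (edge : Fin (length (E H)) → Fin (length (E G)))
         (lookup-edge : ∀ i → L.lookup (E G) (edge i) ≡ L.lookup (E H) i) where

  δ-restrict : ∀ A i → δ G A (edge i) ≡ δ H (A ∩ V H) i
  δ-restrict A i = trans (cong (δᵉ A) (lookup-edge i))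
    (sym (δᵉ-cong {A = A ∩ V H} {A} (L.lookup (E H) i) (lookup-∩ A (V H) (proj₁ (endpoints∈V simple i)))
                                      (lookup-∩ A (V H) (proj₂ (endpoints∈V simple i)))))

  cutSum-restrict : ∀ As i → proj₁ (cutSum G As) (edge i) ≡ proj₁ (cutSum H (map (_∩ V H) As)) i
  cutSum-restrict [] i = refl
  cutSum-restrict (A ∷ As) i = cong₂ ℤ._+_ (δ-restrict A i) (cutSum-restrict As i)

  MG-restrict : ∀ {p} → MG G p → MG H ((λ i → proj₁ p (edge i)) , proj₂ p)
  MG-restrict (As , As⊆V , (x≗ , a≡)) =
    map (_∩ V H) As , Allₚ.map⁺ (All.tabulate (λ {A} _ {x} → Subₚ.p∩q⊆q A (V H) {x})) ,
    (λ i → trans (x≗ (edge i)) (cutSum-restrict As i)) ,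
    trans a≡ (trans (cutSum-last G As)
      (sym (trans (cutSum-last H (map (_∩ V H) As)) (cong ℤ.+_ (Lₚ.length-map (_∩ V H) As)))))

xor-cancelʳ : ∀ a b f → (a xor f) xor (b xor f) ≡ a xor b
xor-cancelʳ a b false rewrite Boolₚ.xor-identityʳ a | Boolₚ.xor-identityʳ b = refl
xor-cancelʳ false false true = refl
xor-cancelʳ false true  true = refl
xor-cancelʳ true  false true = refl
xor-cancelʳ true  true  true = refl

xor-xor-cancel : ∀ a b → b xor (a xor b) ≡ a
xor-xor-cancel a false = Boolₚ.xor-identityʳ a
xor-xor-cancel false true = refl
xor-xor-cancel true true = refl

module ZeroSum {n} {G₁ G₂ : Graph n} {v : Fin n} (simple₁ : IsSimple G₁) (simple₂ : IsSimple G₂)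
               (shared : ShareExactlyVertex G₁ G₂ v) where

  open EdgeSplit {length (E G₁)} {length (E G₂)} (length-++ (E G₁) {E G₂}) public

  G : Graph n
  G = G₁ #₀ G₂

  lookup-left : ∀ i → L.lookup (E G) (left i) ≡ L.lookup (E G₁) i
  lookup-left i = trans (lookup-++ (E G₁) (E G₂) (left i)) (join-left _ _ i)

  lookup-right : ∀ i → L.lookup (E G) (right i) ≡ L.lookup (E G₂) i
  lookup-right i = trans (lookup-++ (E G₁) (E G₂) (right i)) (join-right _ _ i)

  MG-restrictˡ : ∀ {p} → MG G p → MG G₁ (restrictˡ p)
  MG-restrictˡ = MG-restrict {G = G} simple₁ left lookup-left

  MG-restrictʳ : ∀ {p} → MG G p → MG G₂ (restrictʳ p)
  MG-restrictʳ = MG-restrict {G = G} simple₂ right lookup-right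

  mismatch : Subset n → Subset n → Bool
  mismatch A B = lookup A v xor lookup B v

  -- A on V(G₁), and on V(G₂) whichever of B and its complement agrees with A at v;
  -- complementing B does not change δ_B.
  glue : Subset n → Subset n → Subset n
  glue A B = tabulate λ u →
    if lookup (V G₁) u then lookup A u else lookup (V G₂) u ∧ (lookup B u xor mismatch A B)

  glue-V₁ : ∀ A B {u} → lookup (V G₁) u ≡ true → lookup (glue A B) u ≡ lookup A u
  glue-V₁ A B {u} u∈V₁ rewrite Vecₚ.lookup∘tabulate (λ u → if lookup (V G₁) u then lookup A u
                                   else lookup (V G₂) u ∧ (lookup B u xor mismatch A B)) u | u∈V₁ = refl

  glue-V₂ : ∀ A B {u} → lookup (V G₂) u ≡ true → lookup (glue A B) u ≡ lookup B u xor mismatch A B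
  glue-V₂ A B {u} u∈V₂ with lookup (V G₁) u in u∈V₁?
  ... | true = begin
    lookup (glue A B) u            ≡⟨ glue-V₁ A B u∈V₁? ⟩
    lookup A u                     ≡⟨ cong (lookup A) u≡v ⟩
    lookup A v                     ≡⟨ xor-xor-cancel (lookup A v) (lookup B v) ⟨
    lookup B v xor mismatch A B    ≡⟨ cong (λ w → lookup B w xor mismatch A B) u≡v ⟨
    lookup B u xor mismatch A B    ∎
    where
    open ≡-Reasoning
    u≡v : u ≡ v
    u≡v = proj₁ (proj₂ (proj₂ shared)) u (Vecₚ.lookup⇒[]= u _ u∈V₁?) (Vecₚ.lookup⇒[]= u _ u∈V₂)
  ... | false rewrite Vecₚ.lookup∘tabulate (λ u → if lookup (V G₁) u then lookup A u
                         else lookup (V G₂) u ∧ (lookup B u xor mismatch A B)) u | u∈V₁? | u∈V₂ = refl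

  glue⊆V : ∀ A B → glue A B ⊆ V G
  glue⊆V A B {u} u∈glue with lookup (V G₁) u in u∈V₁?
  ... | true = Subₚ.x∈p∪q⁺ (inj₁ (Vecₚ.lookup⇒[]= u _ u∈V₁?))
  ... | false = Subₚ.x∈p∪q⁺ (inj₂ (Vecₚ.lookup⇒[]= u _ (∧-true (trans (sym glued-at-u) (Vecₚ.[]=⇒lookup u∈glue)))))
    where
    glued-at-u : lookup (glue A B) u ≡ lookup (V G₂) u ∧ (lookup B u xor mismatch A B)
    glued-at-u rewrite Vecₚ.lookup∘tabulate (λ u → if lookup (V G₁) u then lookup A u
                         else lookup (V G₂) u ∧ (lookup B u xor mismatch A B)) u | u∈V₁? = refl
    ∧-true : ∀ {a b} → a ∧ b ≡ true → a ≡ true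
    ∧-true {true} _ = refl

  δ-glue : ∀ A B j → δ G (glue A B) j ≡ join (δ G₁ A) (δ G₂ B) j
  δ-glue A B j = begin
    δᵉ (glue A B) (L.lookup (E G) j)                            ≡⟨ cong (δᵉ (glue A B)) (lookup-++ (E G₁) (E G₂) j) ⟩
    δᵉ (glue A B) (join (L.lookup (E G₁)) (L.lookup (E G₂)) j)  ≡⟨ join-map (δᵉ (glue A B)) _ _ j ⟩
    join (λ i → δᵉ (glue A B) (L.lookup (E G₁) i)) (λ i → δᵉ (glue A B) (L.lookup (E G₂) i)) j
                                                                ≡⟨ join-cong on-G₁ on-G₂ j ⟩
    join (δ G₁ A) (δ G₂ B) j                                    ∎
    where
    open ≡-Reasoning
    on-G₁ : ∀ i → δᵉ (glue A B) (L.lookup (E G₁) i) ≡ δ G₁ A i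
    on-G₁ i = δᵉ-cong {A = glue A B} {A} (L.lookup (E G₁) i) (glue-V₁ A B (proj₁ (endpoints∈V simple₁ i)))
                                           (glue-V₁ A B (proj₂ (endpoints∈V simple₁ i)))
    on-G₂ : ∀ i → δᵉ (glue A B) (L.lookup (E G₂) i) ≡ δ G₂ B i
    on-G₂ i rewrite glue-V₂ A B (proj₁ (endpoints∈V simple₂ i)) | glue-V₂ A B (proj₂ (endpoints∈V simple₂ i)) =
      cong (λ b → if b then ℤ.+ 1 else ℤ.+ 0)
        (xor-cancelʳ (lookup B (proj₁ (L.lookup (E G₂) i))) (lookup B (proj₂ (L.lookup (E G₂) i))) (mismatch A B))

  glue⊆V-zipWith : ∀ As Bs → All (_⊆ V G) (L.zipWith glue As Bs)
  glue⊆V-zipWith [] Bs = []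
  glue⊆V-zipWith (A ∷ As) [] = []
  glue⊆V-zipWith (A ∷ As) (B ∷ Bs) = (λ {x} → glue⊆V A B {x}) ∷ glue⊆V-zipWith As Bs

  cutSum-glue : ∀ As Bs → length As ≡ length Bs → ∀ j →
    proj₁ (cutSum G (L.zipWith glue As Bs)) j ≡ join (proj₁ (cutSum G₁ As)) (proj₁ (cutSum G₂ Bs)) j
  cutSum-glue [] [] _ j = sym (join-const (ℤ.+ 0) j)
  cutSum-glue (A ∷ As) (B ∷ Bs) |As|≡|Bs| j =
    trans (cong₂ ℤ._+_ (δ-glue A B j) (cutSum-glue As Bs (ℕP.suc-injective |As|≡|Bs|) j))
          (join-zipWith ℤ._+_ (δ G₁ A) (δ G₂ B) _ _ j)

  cutSum-glue-last : ∀ As Bs → length As ≡ length Bs →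
    proj₂ (cutSum G (L.zipWith glue As Bs)) ≡ proj₂ (cutSum G₁ As)
  cutSum-glue-last [] [] _ = refl
  cutSum-glue-last (A ∷ As) (B ∷ Bs) |As|≡|Bs| =
    cong (λ u → ℤ.+ 1 ℤ.+ u) (cutSum-glue-last As Bs (ℕP.suc-injective |As|≡|Bs|))

  MG-glue : ∀ {x y β} → MG G₁ (x , β) → MG G₂ (y , β) → MG G (join x y , β)
  MG-glue {x} {y} {β} (As , As⊆V , (x≗ , β≡)) (Bs , Bs⊆V , (y≗ , β≡')) =
    L.zipWith glue As Bs , glue⊆V-zipWith As Bs ,
    (λ j → trans (join-cong x≗ y≗ j) (sym (cutSum-glue As Bs |As|≡|Bs| j))) ,
    trans β≡ (sym (cutSum-glue-last As Bs |As|≡|Bs|))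
    where
    |As|≡|Bs| : length As ≡ length Bs
    |As|≡|Bs| = ℤP.+-injective (trans (sym (trans β≡ (cutSum-last G₁ As))) (trans β≡' (cutSum-last G₂ Bs)))

  MG-extendˡ : ∀ {p} → MG G₁ p → MG G (extendˡ (ℤ.+ 0) p)
  MG-extendˡ p∈M = MG-glue p∈M (MG-resp G₂ ((λ _ → refl) , sym (MG-last G₁ p∈M)) (MG-zero G₂ _))

  MG-extendʳ : ∀ {p} → MG G₂ p → MG G (extendʳ (ℤ.+ 0) p)
  MG-extendʳ p∈M = MG-glue (MG-resp G₁ ((λ _ → refl) , sym (MG-last G₂ p∈M)) (MG-zero G₁ _)) p∈M

  Cone-restrictˡ : ∀ {z} → Cone (MG G) z → Cone (MG G₁) (restrictˡ z)
  Cone-restrictˡ = Cone-map restrictˡ-coord (λ p p∈M → Cone-point (MG-restrictˡ p∈M))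

  Cone-restrictʳ : ∀ {z} → Cone (MG G) z → Cone (MG G₂) (restrictʳ z)
  Cone-restrictʳ = Cone-map restrictʳ-coord (λ p p∈M → Cone-point (MG-restrictʳ p∈M))

  Cone-extendˡ : ∀ {z} → Cone (MG G₁) z → Cone (MG G) (extendˡ 0ℚ z)
  Cone-extendˡ = Cone-map extendˡ-coord (λ p p∈M → Cone-resp (toQ-extend p) (Cone-point (MG-extendˡ p∈M)))
    where
    toQ-extend : ∀ p → toQ (extendˡ (ℤ.+ 0) p) ≐ extendˡ 0ℚ (toQ p)
    toQ-extend p zero = refl
    toQ-extend p (suc j) = join-map ι (proj₁ p) (λ _ → ℤ.+ 0) j

  Cone-extendʳ : ∀ {z} → Cone (MG G₂) z → Cone (MG G) (extendʳ 0ℚ z)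
  Cone-extendʳ = Cone-map extendʳ-coord (λ p p∈M → Cone-resp (toQ-extend p) (Cone-point (MG-extendʳ p∈M)))
    where
    toQ-extend : ∀ p → toQ (extendʳ (ℤ.+ 0) p) ≐ extendʳ 0ℚ (toQ p)
    toQ-extend p zero = refl
    toQ-extend p (suc j) = join-map ι (λ _ → ℤ.+ 0) (proj₁ p) j

  -- z is recovered from cut combinations of its two restrictions by gluing every pair
  -- of cuts, with weight the product of their coefficients divided by γ, the common
  -- last coordinate (the total weight of either combination).
  module FibreProduct {z : QPt (length (E G))} {ds₁ ds₂ : List (ℚ × Subset n)}
           (ds₁∈ : All (λ d → (0ℚ ≤ proj₁ d) × (proj₂ d ⊆ V G₁)) ds₁)
           (z₁≐ : restrictˡ z ≐ lincomb (map (cutTerm G₁) ds₁))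
           (ds₂∈ : All (λ d → (0ℚ ≤ proj₁ d) × (proj₂ d ⊆ V G₂)) ds₂)
           (z₂≐ : restrictʳ z ≐ lincomb (map (cutTerm G₂) ds₂)) where

    γ : ℚ
    γ = coord z zero

    weight : ℚ × Subset n → ℚ
    weight d = proj₁ d * 1ℚ

    γ≡₁ : γ ≡ ∑ weight ds₁
    γ≡₁ = trans (z₁≐ zero) (coord-cutCombination G₁ ds₁ zero)

    γ≡₂ : γ ≡ ∑ weight ds₂
    γ≡₂ = trans (z₂≐ zero) (coord-cutCombination G₂ ds₂ zero)

    z-left : ∀ i → proj₁ z (left i) ≡ ∑ (λ d → proj₁ d * ι (δ G₁ (proj₂ d) i)) ds₁
    z-left i = trans (z₁≐ (suc i)) (coord-cutCombination G₁ ds₁ (suc i))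

    z-right : ∀ i → proj₁ z (right i) ≡ ∑ (λ d → proj₁ d * ι (δ G₂ (proj₂ d) i)) ds₂
    z-right i = trans (z₂≐ (suc i)) (coord-cutCombination G₂ ds₂ (suc i))

    0≤weight : ∀ {H : Graph n} {ds} → All (λ d → (0ℚ ≤ proj₁ d) × (proj₂ d ⊆ V H)) ds → All (λ d → 0ℚ ≤ weight d) ds
    0≤weight = All.map (λ (0≤d , _) → ℚP.≤-trans 0≤d (ℚP.≤-reflexive (sym (ℚP.*-identityʳ _))))

    0≤γ : 0ℚ ≤ γ
    0≤γ = ℚP.≤-trans (∑-nonNeg {f = weight} (0≤weight {G₁} ds₁∈)) (ℚP.≤-reflexive (sym γ≡₁))

    ∑-weightless : ∀ {ds} (f : ℚ × Subset n → ℚ) → All (λ d → weight d ≡ 0ℚ) ds → ∑ (λ d → proj₁ d * f d) ds ≡ 0ℚ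
    ∑-weightless {ds} f weights≡0 = trans (∑-congᴬ (All.map (λ {d} → vanish {d}) weights≡0)) (∑-0 ds)
      where
      vanish : ∀ {d} → weight d ≡ 0ℚ → proj₁ d * f d ≡ 0ℚ
      vanish {d} w≡0 = trans (cong (_* f d) (trans (sym (ℚP.*-identityʳ (proj₁ d))) w≡0)) (ℚP.*-zeroˡ (f d))

    degenerate : γ ≡ 0ℚ → ∀ k → coord z k ≡ 0ℚ
    degenerate γ≡0 zero = γ≡0
    degenerate γ≡0 (suc j) = begin
      proj₁ z j                                          ≡⟨ join-restrict (proj₁ z) j ⟨
      join (λ i → proj₁ z (left i)) (λ i → proj₁ z (right i)) j
        ≡⟨ join-cong (λ i → trans (z-left i) (∑-weightless _ weights≡0₁))
                     (λ i → trans (z-right i) (∑-weightless _ weights≡0₂)) j ⟩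
      join (λ _ → 0ℚ) (λ _ → 0ℚ) j                       ≡⟨ join-const 0ℚ j ⟩
      0ℚ                                                 ∎
      where
      open ≡-Reasoning
      weights≡0₁ = ∑-nonNeg-≡0 {f = weight} (0≤weight {G₁} ds₁∈) (trans (sym γ≡₁) γ≡0)
      weights≡0₂ = ∑-nonNeg-≡0 {f = weight} (0≤weight {G₂} ds₂∈) (trans (sym γ≡₂) γ≡0)

    product : ℚ → List (ℚ × Subset n)
    product c = L.concatMap (λ d → map (λ e → proj₁ d * proj₁ e * c , glue (proj₂ d) (proj₂ e)) ds₂) ds₁

    product∈ : ∀ {c} → 0ℚ ≤ c → All (λ d → (0ℚ ≤ proj₁ d) × (proj₂ d ⊆ V G)) (product c)
    product∈ 0≤c = Allₚ.concat⁺ (Allₚ.map⁺ (All.map (λ {d} (0≤d , _) →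
      Allₚ.map⁺ (All.map (λ {e} (0≤e , _) →
        0≤*0≤ (0≤*0≤ 0≤d 0≤e) 0≤c , λ {x} → glue⊆V (proj₂ d) (proj₂ e) {x}) ds₂∈)) ds₁∈))

    coord-product : ∀ c k → coord (lincomb (map (cutTerm G) (product c))) k ≡
      ∑ (λ d → ∑ (λ e → proj₁ d * proj₁ e * c * ι (coord (cutPt G (glue (proj₂ d) (proj₂ e))) k)) ds₂) ds₁
    coord-product c k = begin
      coord (lincomb (map (cutTerm G) (product c))) k     ≡⟨ coord-cutCombination G (product c) k ⟩
      ∑ F (product c)                                     ≡⟨ ∑-concatMap F _ ds₁ ⟩
      ∑ (λ d → ∑ F (map (λ e → proj₁ d * proj₁ e * c , glue (proj₂ d) (proj₂ e)) ds₂)) ds₁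
                                                          ≡⟨ ∑-cong ds₁ (λ d → ∑-map F _ ds₂) ⟩
      _                                                   ∎
      where
      open ≡-Reasoning
      F : ℚ × Subset n → ℚ
      F d = proj₁ d * ι (coord (cutPt G (proj₂ d)) k)

    ·γc : ∀ {c} a → γ * c ≡ 1ℚ → a * γ * c ≡ a
    ·γc {c} a γc≡1 = trans (ℚP.*-assoc a γ c) (trans (cong (a *_) γc≡1) (ℚP.*-identityʳ a))

    recover : ∀ {c} → γ * c ≡ 1ℚ → z ≐ lincomb (map (cutTerm G) (product c))
    recover {c} γc≡1 zero = sym (begin
      coord (lincomb (map (cutTerm G) (product c))) zero  ≡⟨ coord-product c zero ⟩
      ∑ (λ d → ∑ (λ e → proj₁ d * proj₁ e * c * 1ℚ) ds₂) ds₁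
        ≡⟨ ∑-cong ds₁ (λ d → ∑-cong ds₂ (λ e → regroup (proj₁ d) (proj₁ e) c)) ⟩
      ∑ (λ d → ∑ (λ e → weight d * weight e * c) ds₂) ds₁ ≡⟨ ∑∑-* ds₁ ds₂ weight weight c ⟩
      ∑ weight ds₁ * ∑ weight ds₂ * c                     ≡⟨ cong₂ (λ u w → u * w * c) γ≡₁ γ≡₂ ⟨
      γ * γ * c                                           ≡⟨ ·γc γ γc≡1 ⟩
      γ                                                   ∎)
      where
      open ≡-Reasoning
      regroup : ∀ a b c → a * b * c * 1ℚ ≡ (a * 1ℚ) * (b * 1ℚ) * c
      regroup = solve 3 (λ a b c → a :* b :* c :* con 1ℚ := (a :* con 1ℚ) :* (b :* con 1ℚ) :* c) refl
        where open +-*-Solver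
    recover {c} γc≡1 (suc j) = trans (on-side j (side j) refl) (sym (trans (coord-product c (suc j))
      (∑-cong ds₁ λ d → ∑-cong ds₂ λ e → cong (λ u → proj₁ d * proj₁ e * c * ι u) (δ-glue (proj₂ d) (proj₂ e) j))))
      where
      open ≡-Reasoning
      on-side : ∀ j s → side j ≡ s → proj₁ z j ≡
        ∑ (λ d → ∑ (λ e → proj₁ d * proj₁ e * c * ι ([ δ G₁ (proj₂ d) , δ G₂ (proj₂ e) ]′ s)) ds₂) ds₁
      on-side j (inj₁ i) side≡ = sym (begin
        ∑ (λ d → ∑ (λ e → proj₁ d * proj₁ e * c * x' d) ds₂) ds₁
          ≡⟨ ∑-cong ds₁ (λ d → ∑-cong ds₂ (λ e → regroup (proj₁ d) (proj₁ e) c (x' d))) ⟩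
        ∑ (λ d → ∑ (λ e → proj₁ d * x' d * weight e * c) ds₂) ds₁
                                                      ≡⟨ ∑∑-* ds₁ ds₂ (λ d → proj₁ d * x' d) weight c ⟩
        ∑ (λ d → proj₁ d * x' d) ds₁ * ∑ weight ds₂ * c ≡⟨ cong₂ (λ u w → u * w * c) (z-left i) γ≡₂ ⟨
        proj₁ z (left i) * γ * c                      ≡⟨ ·γc (proj₁ z (left i)) γc≡1 ⟩
        proj₁ z (left i)                              ≡⟨ cong (proj₁ z) (left-side side≡) ⟩
        proj₁ z j                                     ∎)
        where
        x' : ℚ × Subset n → ℚ
        x' d = ι (δ G₁ (proj₂ d) i)
        regroup : ∀ a b c u → a * b * c * u ≡ a * u * (b * 1ℚ) * c
        regroup = solve 4 (λ a b c u → a :* b :* c :* u := a :* u :* (b :* con 1ℚ) :* c) refl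
          where open +-*-Solver
      on-side j (inj₂ i) side≡ = sym (begin
        ∑ (λ d → ∑ (λ e → proj₁ d * proj₁ e * c * y e) ds₂) ds₁
          ≡⟨ ∑-cong ds₁ (λ d → ∑-cong ds₂ (λ e → regroup (proj₁ d) (proj₁ e) c (y e))) ⟩
        ∑ (λ d → ∑ (λ e → weight d * (proj₁ e * y e) * c) ds₂) ds₁
                                                      ≡⟨ ∑∑-* ds₁ ds₂ weight (λ e → proj₁ e * y e) c ⟩
        ∑ weight ds₁ * ∑ (λ e → proj₁ e * y e) ds₂ * c ≡⟨ cong₂ (λ u w → u * w * c) γ≡₁ (z-right i) ⟨
        γ * proj₁ z (right i) * c                     ≡⟨ cong (_* c) (ℚP.*-comm γ _) ⟩
        proj₁ z (right i) * γ * c                     ≡⟨ ·γc (proj₁ z (right i)) γc≡1 ⟩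
        proj₁ z (right i)                             ≡⟨ cong (proj₁ z) (right-side side≡) ⟩
        proj₁ z j                                     ∎)
        where
        y : ℚ × Subset n → ℚ
        y e = ι (δ G₂ (proj₂ e) i)
        regroup : ∀ a b c u → a * b * c * u ≡ a * 1ℚ * (b * u) * c
        regroup = solve 4 (λ a b c u → a :* b :* c :* u := a :* con 1ℚ :* (b :* u) :* c) refl
          where open +-*-Solver

    cone : Cone (MG G) z
    cone with γ ℚP.≟ 0ℚ
    ... | yes γ≡0 = Cone-zero (degenerate γ≡0)
    ... | no γ≢0 with inverse-nonNeg γ 0≤γ γ≢0
    ...   | c , 0≤c , γc≡1 = CutCombination⇒Cone G (product c , product∈ 0≤c , recover γc≡1)

  Cone-fibre : ∀ {z} → Cone (MG G₁) (restrictˡ z) → Cone (MG G₂) (restrictʳ z) → Cone (MG G) z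
  Cone-fibre z₁∈C z₂∈C with Cone⇒CutCombination G₁ z₁∈C | Cone⇒CutCombination G₂ z₂∈C
  ... | ds₁ , ds₁∈ , z₁≐ | ds₂ , ds₂∈ , z₂≐ = FibreProduct.cone ds₁∈ z₁≐ ds₂∈ z₂≐

  intMG-restrictˡ : ∀ {p} → intMG G p → intMG G₁ (restrictˡ p)
  intMG-restrictˡ (p∈M , p∈relint) = MG-restrictˡ p∈M ,
    RelInt-retraction restrictˡ-coord extendˡ-coord Cone-restrictˡ Cone-extendˡ restrictˡ∘extendˡ p∈relint

  intMG-restrictʳ : ∀ {p} → intMG G p → intMG G₂ (restrictʳ p)
  intMG-restrictʳ (p∈M , p∈relint) = MG-restrictʳ p∈M ,
    RelInt-retraction restrictʳ-coord extendʳ-coord Cone-restrictʳ Cone-extendʳ restrictʳ∘extendʳ p∈relint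

  intMG-glue : ∀ {x y β} → intMG G₁ (x , β) → intMG G₂ (y , β) → intMG G (join x y , β)
  intMG-glue {x} {y} {β} (x∈M , x∈relint) (y∈M , y∈relint) = xy∈M ,
    RelInt-fibre restrictˡ-coord restrictʳ-coord Cone-restrictˡ Cone-restrictʳ Cone-fibre (Cone-point xy∈M)
      (RelInt-resp toQ-left x∈relint) (RelInt-resp toQ-right y∈relint)
    where
    xy∈M : MG G (join x y , β)
    xy∈M = MG-glue x∈M y∈M
    toQ-left : toQ (x , β) ≐ restrictˡ (toQ (join x y , β))
    toQ-left zero = refl
    toQ-left (suc i) = cong ι (sym (join-left x y i))
    toQ-right : toQ (y , β) ≐ restrictʳ (toQ (join x y , β))
    toQ-right zero = refl
    toQ-right (suc i) = cong ι (sym (join-right x y i))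

  join-summands : ∀ {p s₁ q₁ s₂ q₂} → restrictˡ p ≈ᵖ (s₁ +ᵖ q₁) → restrictʳ p ≈ᵖ (s₂ +ᵖ q₂) →
                  ∀ j → proj₁ p j ≡ join (proj₁ s₁) (proj₁ s₂) j ℤ.+ join (proj₁ q₁) (proj₁ q₂) j
  join-summands {p} {s₁} {q₁} {s₂} {q₂} (p₁≗ , _) (p₂≗ , _) j = begin
    proj₁ p j                                                      ≡⟨ join-restrict (proj₁ p) j ⟨
    join (λ i → proj₁ p (left i)) (λ i → proj₁ p (right i)) j      ≡⟨ join-cong p₁≗ p₂≗ j ⟩
    join (λ i → proj₁ s₁ i ℤ.+ proj₁ q₁ i) (λ i → proj₁ s₂ i ℤ.+ proj₁ q₂ i) j
      ≡⟨ join-zipWith ℤ._+_ (proj₁ s₁) (proj₁ s₂) (proj₁ q₁) (proj₁ q₂) j ⟨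
    join (proj₁ s₁) (proj₁ s₂) j ℤ.+ join (proj₁ q₁) (proj₁ q₂) j  ∎
    where open ≡-Reasoning

-- Generators of the interior

module _ {n} (H : Graph n) where

  intMG-resp : ∀ {p q} → p ≈ᵖ q → intMG H p → intMG H q
  intMG-resp {p} {q} p≈q (p∈M , p∈relint) = MG-resp H p≈q p∈M , RelInt-resp toQ-≐ p∈relint
    where
    toQ-≐ : toQ p ≐ toQ q
    toQ-≐ k = trans (coord-toQ p k) (trans (cong ι (≈ᵖ⇒coord p≈q k)) (sym (coord-toQ q k)))

  intMG-+ : ∀ {s q} → intMG H s → MG H q → intMG H (s +ᵖ q)
  intMG-+ {s} {q} (s∈M , s∈relint) q∈M = MG-+ H s∈M q∈M ,
    RelInt-+Cone s∈relint (Cone-point q∈M) λ k → begin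
      coord (toQ (s +ᵖ q)) k                     ≡⟨ coord-toQ (s +ᵖ q) k ⟩
      ι (coord (s +ᵖ q) k)                       ≡⟨ cong ι (coord-+ᵖ s q k) ⟩
      ι (coord s k ℤ.+ coord q k)                ≡⟨ ι-homo-+ (coord s k) (coord q k) ⟩
      ι (coord s k) + ι (coord q k)              ≡⟨ cong₂ _+_ (coord-toQ s k) (coord-toQ q k) ⟨
      coord (toQ s) k + coord (toQ q) k          ∎
    where open ≡-Reasoning

  last-+ : ∀ {p s q a} (q∈M : MG H q) → p ≈ᵖ (s +ᵖ q) → proj₂ s ≡ ℤ.+ a →
           proj₂ p ≡ ℤ.+ (a ℕ.+ length (proj₁ q∈M))
  last-+ {a = a} q∈M (_ , p≡) s≡ = trans p≡ (trans (cong₂ ℤ._+_ s≡ (MG-last H q∈M)) (sym (ℤP.pos-+ a _)))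

  InteriorSplit : Pt (length (E H)) → ℕ → Set
  InteriorSplit p b = ∃₂ λ s q → intMG H s × MG H q × p ≈ᵖ (s +ᵖ q) × proj₂ s ≡ ℤ.+ b

  intMG-shift : ∀ {p s q a b} → intMG H s → (q∈M : MG H q) → p ≈ᵖ (s +ᵖ q) → proj₂ s ≡ ℤ.+ a →
                a ℕ.≤ b → b ℕ.≤ a ℕ.+ length (proj₁ q∈M) → InteriorSplit p b
  intMG-shift {p} {s} {q} {a} {b} s∈int q∈M p≈ s≡ a≤b b≤
    with MG-split H q∈M (b ℕ.∸ a) (ℕP.m≤n+o⇒m∸n≤o b a b≤)
  ... | q' , q'' , q'∈M , q''∈M , q'≡ , q≈ =
    s +ᵖ q' , q'' , intMG-+ s∈int q'∈M , q''∈M , coord⇒≈ᵖ reassociate , last≡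
    where
    open ≡-Reasoning
    reassociate : ∀ k → coord p k ≡ coord ((s +ᵖ q') +ᵖ q'') k
    reassociate k = begin
      coord p k                                            ≡⟨ ≈ᵖ⇒coord p≈ k ⟩
      coord (s +ᵖ q) k                                     ≡⟨ coord-+ᵖ s q k ⟩
      coord s k ℤ.+ coord q k
        ≡⟨ cong (λ u → coord s k ℤ.+ u) (trans (≈ᵖ⇒coord q≈ k) (coord-+ᵖ q' q'' k)) ⟩
      coord s k ℤ.+ (coord q' k ℤ.+ coord q'' k)           ≡⟨ ℤP.+-assoc (coord s k) _ _ ⟨
      coord s k ℤ.+ coord q' k ℤ.+ coord q'' k             ≡⟨ cong (ℤ._+ coord q'' k) (coord-+ᵖ s q' k) ⟨
      coord (s +ᵖ q') k ℤ.+ coord q'' k                    ≡⟨ coord-+ᵖ (s +ᵖ q') q'' k ⟨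
      coord ((s +ᵖ q') +ᵖ q'') k                           ∎
    last≡ : proj₂ s ℤ.+ proj₂ q' ≡ ℤ.+ b
    last≡ = begin
      proj₂ s ℤ.+ proj₂ q'                                 ≡⟨ cong₂ ℤ._+_ s≡ q'≡ ⟩
      ℤ.+ a ℤ.+ ℤ.+ (b ℕ.∸ a)                              ≡⟨ ℤP.pos-+ a (b ℕ.∸ a) ⟨
      ℤ.+ (a ℕ.+ (b ℕ.∸ a))                                ≡⟨ cong ℤ.+_ (ℕP.m+[n∸m]≡n a≤b) ⟩
      ℤ.+ b                                                ∎

Decomposition : ∀ {m} → (Pt m → Set) → (Pt m → Set) → Pt m → Set
Decomposition M S p = ∃₂ λ s q → S s × M q × p ≈ᵖ (s +ᵖ q)

module Generators {n} {G₁ G₂ : Graph n} {v : Fin n} (simple₁ : IsSimple G₁) (simple₂ : IsSimple G₂)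
                  (shared : ShareExactlyVertex G₁ G₂ v) (W₁ W₂ : List ℕ)
                  {S₁ : Pt (length (E G₁)) → Set} (S₁-gen : GenSys (MG G₁) (intMG G₁) S₁)
                  (S₁-last : ∀ p → S₁ p → InW W₁ (proj₂ p))
                  {S₂ : Pt (length (E G₂)) → Set} (S₂-gen : GenSys (MG G₂) (intMG G₂) S₂)
                  (S₂-last : ∀ p → S₂ p → InW W₂ (proj₂ p)) where

  open ZeroSum simple₁ simple₂ shared

  Admissible : ℤ → Set
  Admissible β = (InW W₁ β ⊎ InW W₂ β) × GeMin W₁ β × GeMin W₂ β

  admissible-⊔ : ∀ {a b} → a LM.∈ W₁ → b LM.∈ W₂ → Admissible (ℤ.+ (a ℕ.⊔ b))
  admissible-⊔ {a} {b} a∈W₁ b∈W₂ = larger , (a , a∈W₁ , ℤ.+≤+ (ℕP.m≤m⊔n a b)) , (b , b∈W₂ , ℤ.+≤+ (ℕP.m≤n⊔m a b))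
    where
    larger : InW W₁ (ℤ.+ (a ℕ.⊔ b)) ⊎ InW W₂ (ℤ.+ (a ℕ.⊔ b))
    larger with ℕP.⊔-sel a b
    ... | inj₁ a⊔b≡a = inj₁ (a , a∈W₁ , cong ℤ.+_ a⊔b≡a)
    ... | inj₂ a⊔b≡b = inj₂ (b , b∈W₂ , cong ℤ.+_ a⊔b≡b)

  GluedGenerator : Pt (length (E G)) → Set
  GluedGenerator p =
    ∃ λ (x : Vector ℤ (length (E G₁))) → ∃ λ (y : Vector ℤ (length (E G₂))) → ∃ λ (β : ℤ) →
        p ≈ᵖ (joinVec G₁ G₂ x y , β)
      × (InW W₁ β ⊎ InW W₂ β) × GeMin W₁ β × GeMin W₂ β
      × intMG G₁ (x , β) × intMG G₂ (y , β)

  InW⇒GeMin : ∀ {W β} → InW W β → GeMin W β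
  InW⇒GeMin (w , w∈W , β≡w) = w , w∈W , ℤP.≤-reflexive (sym β≡w)

  GluedGenerator⊆int : ∀ p → GluedGenerator p → intMG G p
  GluedGenerator⊆int p (x , y , β , p≈ , _ , _ , _ , x∈int , y∈int) =
    intMG-resp G (≈ᵖ-sym p≈) (intMG-glue x∈int y∈int)

  generator-pair : ∀ β x y → InW W₁ β → InW W₂ β → S₁ (x , β) → S₂ (y , β) → GluedGenerator (joinVec G₁ G₂ x y , β)
  generator-pair β x y β∈W₁ β∈W₂ x∈S₁ y∈S₂ =
    x , y , β , ((λ _ → refl) , refl) , inj₁ β∈W₁ , InW⇒GeMin β∈W₁ , InW⇒GeMin β∈W₂ ,
    proj₁ S₁-gen _ x∈S₁ , proj₁ S₂-gen _ y∈S₂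

  glue-splits : ∀ {p β} → InteriorSplit G₁ (restrictˡ p) β → InteriorSplit G₂ (restrictʳ p) β →
                Admissible (ℤ.+ β) → Decomposition (MG G) GluedGenerator p
  glue-splits {p} {β} (s₁ , q₁ , s₁∈int , q₁∈M , p₁≈ , s₁≡β) (s₂ , q₂ , s₂∈int , q₂∈M , p₂≈ , s₂≡β)
              (β∈W , β≥min₁ , β≥min₂) =
    (join (proj₁ s₁) (proj₁ s₂) , ℤ.+ β) , (join (proj₁ q₁) (proj₁ q₂) , proj₂ q₂) ,
    (proj₁ s₁ , proj₁ s₂ , ℤ.+ β , ((λ _ → refl) , refl) , β∈W , β≥min₁ , β≥min₂ ,
      subst (λ b → intMG G₁ (proj₁ s₁ , b)) s₁≡β s₁∈int , subst (λ b → intMG G₂ (proj₁ s₂ , b)) s₂≡β s₂∈int) ,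
    MG-glue (MG-resp G₁ ((λ _ → refl) , q₁≡q₂) q₁∈M) q₂∈M ,
    (join-summands {p} {s₁} {q₁} {s₂} {q₂} p₁≈ p₂≈ , trans (proj₂ p₂≈) (cong (ℤ._+ proj₂ q₂) s₂≡β))
    where
    s₁≡s₂ : proj₂ s₁ ≡ proj₂ s₂
    s₁≡s₂ = trans s₁≡β (sym s₂≡β)
    q₁≡q₂ : proj₂ q₁ ≡ proj₂ q₂
    q₁≡q₂ = +-cancelˡ (proj₂ s₂) _ _ (begin
      proj₂ s₂ ℤ.+ proj₂ q₁    ≡⟨ cong (ℤ._+ proj₂ q₁) s₁≡s₂ ⟨
      proj₂ s₁ ℤ.+ proj₂ q₁    ≡⟨ proj₂ p₁≈ ⟨
      proj₂ p                  ≡⟨ proj₂ p₂≈ ⟩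
      proj₂ s₂ ℤ.+ proj₂ q₂    ∎)
      where open ≡-Reasoning

  balance : ∀ {p s₁ q₁ s₂ q₂} → InW W₁ (proj₂ s₁) → InW W₂ (proj₂ s₂) → intMG G₁ s₁ → intMG G₂ s₂ →
            MG G₁ q₁ → MG G₂ q₂ → restrictˡ p ≈ᵖ (s₁ +ᵖ q₁) → restrictʳ p ≈ᵖ (s₂ +ᵖ q₂) →
            Decomposition (MG G) GluedGenerator p
  balance {p} {s₁} {q₁} {s₂} {q₂} (a , a∈W₁ , s₁≡a) (b , b∈W₂ , s₂≡b) s₁∈int s₂∈int q₁∈M q₂∈M p₁≈ p₂≈ = glue-splits
    (intMG-shift G₁ {p = restrictˡ p} {s₁} s₁∈int q₁∈M p₁≈ s₁≡a (ℕP.m≤m⊔n a b) (ℕP.⊔-lub (ℕP.m≤m+n a _) b≤))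
    (intMG-shift G₂ {p = restrictʳ p} {s₂} s₂∈int q₂∈M p₂≈ s₂≡b (ℕP.m≤n⊔m a b) (ℕP.⊔-lub a≤ (ℕP.m≤m+n b _)))
    (admissible-⊔ a∈W₁ b∈W₂)
    where
    degrees : a ℕ.+ length (proj₁ q₁∈M) ≡ b ℕ.+ length (proj₁ q₂∈M)
    degrees = ℤP.+-injective (trans (sym (last-+ G₁ {p = restrictˡ p} {s₁} q₁∈M p₁≈ s₁≡a))
                                    (last-+ G₂ {p = restrictʳ p} {s₂} q₂∈M p₂≈ s₂≡b))
    b≤ : b ℕ.≤ a ℕ.+ length (proj₁ q₁∈M)
    b≤ = ℕP.≤-trans (ℕP.m≤m+n b _) (ℕP.≤-reflexive (sym degrees))
    a≤ : a ℕ.≤ b ℕ.+ length (proj₁ q₂∈M)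
    a≤ = ℕP.≤-trans (ℕP.m≤m+n a _) (ℕP.≤-reflexive degrees)

  decompose : ∀ p → intMG G p → Decomposition (MG G) GluedGenerator p
  decompose p p∈int =
    from-restrictions (proj₂ S₁-gen _ (intMG-restrictˡ p∈int)) (proj₂ S₂-gen _ (intMG-restrictʳ p∈int))
    where
    from-restrictions : Decomposition (MG G₁) S₁ (restrictˡ p) → Decomposition (MG G₂) S₂ (restrictʳ p) →
                        Decomposition (MG G) GluedGenerator p
    from-restrictions (s₁ , q₁ , s₁∈S₁ , q₁∈M , p₁≈) (s₂ , q₂ , s₂∈S₂ , q₂∈M , p₂≈) =
      balance (S₁-last s₁ s₁∈S₁) (S₂-last s₂ s₂∈S₂) (proj₁ S₁-gen s₁ s₁∈S₁) (proj₁ S₂-gen s₂ s₂∈S₂)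
              q₁∈M q₂∈M p₁≈ p₂≈

lemma5p6 : ∀ {n} (G₁ G₂ : Graph n) (v : Fin n) →
    IsSimple G₁ → IsSimple G₂ →
    K5MinorFree G₁ → K5MinorFree G₂ →
    ShareExactlyVertex G₁ G₂ v →
    (W₁ W₂ : List ℕ) →
    (S₁ : Pt (length (E G₁)) → Set) →
    GenSys (MG G₁) (intMG G₁) S₁ →
    (∀ p → S₁ p → InW W₁ (proj₂ p)) →
    (S₂ : Pt (length (E G₂)) → Set) →
    GenSys (MG G₂) (intMG G₂) S₂ →
    (∀ p → S₂ p → InW W₂ (proj₂ p)) →
    ∃ λ (S : Pt (length (E (G₁ #₀ G₂))) → Set) →
        GenSys (MG (G₁ #₀ G₂)) (intMG (G₁ #₀ G₂)) S
      × (∀ p → S p →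
           ∃ λ (x : Vector ℤ (length (E G₁))) →
           ∃ λ (y : Vector ℤ (length (E G₂))) →
           ∃ λ (β : ℤ) →
               p ≈ᵖ (joinVec G₁ G₂ x y , β)
             × (InW W₁ β ⊎ InW W₂ β)
             × GeMin W₁ β × GeMin W₂ β
             × intMG G₁ (x , β) × intMG G₂ (y , β))
      × (∀ (β : ℤ) x y → InW W₁ β → InW W₂ β →
           S₁ (x , β) → S₂ (y , β) → S (joinVec G₁ G₂ x y , β))
lemma5p6 G₁ G₂ v simple₁ simple₂ _ _ shared W₁ W₂ S₁ S₁-gen S₁-last S₂ S₂-gen S₂-last =
  GluedGenerator , (GluedGenerator⊆int , decompose) , (λ p p∈S → p∈S) , generator-pair
  where open Generators simple₁ simple₂ shared W₁ W₂ S₁-gen S₁-last S₂-gen S₂-last
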